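{- For a positive integer $H$, let $$\mathcal{N}_3(H)=\#\{(a_1,a_2,a_3)\in\mathbb{Z}^3 : 1\le a_1,a_2,a_3\le H,\ \gcd(a_i,a_j)\ne 1 \text{ for all } 1\le i<j\le 3\}.$$ Let $$\rho=1-\frac{3}{\zeta(2)}+3\prod_{p\ \mathrm{prime}}\left(1-\frac{2p-1}{p^3}\right)-\prod_{p\ \mathrm{prime}}\left(1-\frac{3p-2}{p^3}\right),$$ where $\zeta$ is the Riemann zeta function and the products run over all primes $p$. Then there is an absolute constant $C>0$ such that for all integers $H\ge 2$, $$\left|\mathcal{N}_3(H)-\rho H^3\right|\le C\,H^2(\log H)^2,$$ i.e. $\mathcal{N}_3(H)=\rho H^3+O\left(H^2(\log H)^2\right)$.
   Context: A triple $(a_1,a_2,a_3)$ of positive integers is called pairwise non-coprime if $\gcd(a_i,a_j)\ne 1$ for all $1\le i<j\le 3$; $\mathcal{N}_3(H)$ counts such triples with all entries at most $H$. -}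

module Defs where

open import Data.Bool using (Bool; true; false; if_then_else_; _∧_; not)
open import Data.Nat using (ℕ; zero; suc; _≡ᵇ_; _∸_)
import Data.Nat as ℕ
open import Data.Nat.GCD using (gcd)
open import Data.Nat.Primality using (prime?)
open import Data.List using (List; []; _∷_; filter; map; foldr; applyUpTo)
open import Data.Nat.ListAction using (sum)
open import Data.Integer using (ℤ; +_)
open import Data.Rational.Unnormalised.Base
  using (ℚᵘ; mkℚᵘ; 0ℚᵘ; 1ℚᵘ; _+_; _-_; _*_)

range1 : ℕ → List ℕ
range1 H = applyUpTo suc H

nonCoprime : ℕ → ℕ → Bool
nonCoprime a b = not (gcd a b ≡ᵇ 1)

pnc3 : ℕ → ℕ → ℕ → Bool
pnc3 a b c = nonCoprime a b ∧ nonCoprime a c ∧ nonCoprime b c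

ind : Bool → ℕ
ind true = 1
ind false = 0

N3 : ℕ → ℕ
N3 H = sum (map (λ a → sum (map (λ b → sum (map (λ c → ind (pnc3 a b c))
         (range1 H))) (range1 H))) (range1 H))

primesUpTo : ℕ → List ℕ
primesUpTo P = filter prime? (range1 P)

prodPrimes : ℕ → (ℕ → ℚᵘ) → ℚᵘ
prodPrimes P f = foldr (λ p acc → f p * acc) 1ℚᵘ (primesUpTo P)

-- the rational n / d for d ≥ 1 (value 0 when d = 0; never used at d = 0)
frac : ℕ → ℕ → ℚᵘ
frac n zero = 0ℚᵘ
frac n (suc d) = mkℚᵘ (+ n) d

-- Euler factors:  1 - 1/p²,  1 - (2p-1)/p³,  1 - (3p-2)/p³
-- (1/ζ(2) = ∏_p (1 - 1/p²) by the Euler product)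
fac₁ fac₂ fac₃ : ℕ → ℚᵘ
fac₁ p = 1ℚᵘ - frac 1 (p ℕ.* p)
fac₂ p = 1ℚᵘ - frac (2 ℕ.* p ∸ 1) (p ℕ.* p ℕ.* p)
fac₃ p = 1ℚᵘ - frac (3 ℕ.* p ∸ 2) (p ℕ.* p ℕ.* p)

ℕ→ℚ : ℕ → ℚᵘ
ℕ→ℚ n = mkℚᵘ (+ n) 0

-- truncation of ρ at primes ≤ P; ρ = lim_{P→∞} ρTrunc P
ρTrunc : ℕ → ℚᵘ
ρTrunc P = 1ℚᵘ - ℕ→ℚ 3 * prodPrimes P fac₁
              + ℕ→ℚ 3 * prodPrimes P fac₂
              - prodPrimes P fac₃

module Submission where

-- Pairwise non-coprimality of (a, b, c) is (1 - Cᵃᵇ)(1 - Cᵃᶜ)(1 - Cᵇᶜ), where Cˣʸ indicates gcd(x, y) = 1.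
-- For 1 ≤ x ≤ H, Cˣʸ is the Euler product of 1 - [p ∣ x][p ∣ y] over the primes p ≤ P (any P ≥ H), so N₃(H)
-- is a signed sum of eight sums over [1, H]³ of Euler products whose local factors have the form
-- 1 + λX[p ∣ a][p ∣ b] + λY[p ∣ a][p ∣ c] + λZ[p ∣ b][p ∣ c] + λW[p ∣ a][p ∣ b][p ∣ c].
-- Expanding such a product distributes the primes among X, Y, Z, W and turns the sum over the cube into a
-- signed sum of ⌊H/XYW⌋⌊H/XZW⌋⌊H/YZW⌋. Replacing each product of floors by H³/(XYW·XZW·YZW) gives exactly
-- H³ times the truncated Euler product of the local densities, i.e. the corresponding term of ρ H³. The
-- replacement costs at most H² (m(XY)/Z² + m(XZ)/Y² + m(YZ)/X²)/W² with m(n) = min(1/n, H/n²); summing this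
-- over all squarefree X, Y, Z, W factorises into ∑ 1/d² ≤ 2 and a double sum of m(xy), which splitting at
-- xy = H bounds by harmonic sums, hence by O(log² H).

module Rationals where

  open import Data.Nat as ℕ using (ℕ; zero; suc; s≤s; z≤n)
  import Data.Nat.Properties as ℕP
  open import Data.Rational.Base hiding (_/_)
  open import Data.Rational.Properties
  open import Data.Rational.Solver
  open import Data.Product using (_,_; _×_)
  open import Data.Sum using (inj₁; inj₂)
  open import Relation.Nullary.Decidable using (toWitness)
  open import Relation.Binary.PropositionalEquality
  open +-*-Solver

  ι : ℕ → ℚ
  ι zero = 0ℚ
  ι (suc n) = 1ℚ + ι n

  ι-+ : ∀ m n → ι (m ℕ.+ n) ≡ ι m + ι n
  ι-+ zero n = sym (+-identityˡ (ι n))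
  ι-+ (suc m) n = trans (cong (1ℚ +_) (ι-+ m n)) (sym (+-assoc 1ℚ (ι m) (ι n)))

  ι-* : ∀ m n → ι (m ℕ.* n) ≡ ι m * ι n
  ι-* zero n = sym (*-zeroˡ (ι n))
  ι-* (suc m) n = begin
    ι (n ℕ.+ m ℕ.* n)    ≡⟨ ι-+ n (m ℕ.* n) ⟩
    ι n + ι (m ℕ.* n)    ≡⟨ cong (ι n +_) (ι-* m n) ⟩
    ι n + ι m * ι n      ≡⟨ solve 2 (λ a b → a :+ b :* a := (con 1ℚ :+ b) :* a) refl (ι n) (ι m) ⟩
    (1ℚ + ι m) * ι n     ∎
    where open ≡-Reasoning

  ι-∸ : ∀ {m n} → n ℕ.≤ m → ι (m ℕ.∸ n) ≡ ι m - ι n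
  ι-∸ {m} {n} n≤m = begin
    ι (m ℕ.∸ n)                  ≡⟨ solve 2 (λ x y → x := (x :+ y) :- y) refl (ι (m ℕ.∸ n)) (ι n) ⟩
    (ι (m ℕ.∸ n) + ι n) - ι n    ≡⟨ cong (_- ι n) (sym (ι-+ (m ℕ.∸ n) n)) ⟩
    ι (m ℕ.∸ n ℕ.+ n) - ι n      ≡⟨ cong (λ k → ι k - ι n) (ℕP.m∸n+n≡m n≤m) ⟩
    ι m - ι n                    ∎
    where open ≡-Reasoning

  0≤1 : 0ℚ ≤ 1ℚ
  0≤1 = toWitness {a? = 0ℚ ≤? 1ℚ} _

  0≤p+q : ∀ {p q} → 0ℚ ≤ p → 0ℚ ≤ q → 0ℚ ≤ p + q
  0≤p+q {p} {q} 0≤p 0≤q = ≤-trans (≤-reflexive (sym (+-identityʳ 0ℚ))) (+-mono-≤ 0≤p 0≤q)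

  0≤p*q : ∀ {p q} → 0ℚ ≤ p → 0ℚ ≤ q → 0ℚ ≤ p * q
  0≤p*q {p} {q} 0≤p 0≤q = ≤-trans (≤-reflexive (sym (*-zeroˡ q))) (*-monoʳ-≤-nonNeg q {{nonNegative 0≤q}} 0≤p)

  *-monoˡ-≤-0≤ : ∀ {p q} r → 0ℚ ≤ r → p ≤ q → r * p ≤ r * q
  *-monoˡ-≤-0≤ r 0≤r = *-monoˡ-≤-nonNeg r {{nonNegative 0≤r}}

  *-monoʳ-≤-0≤ : ∀ {p q} r → 0ℚ ≤ r → p ≤ q → p * r ≤ q * r
  *-monoʳ-≤-0≤ r 0≤r = *-monoʳ-≤-nonNeg r {{nonNegative 0≤r}}

  *-mono-≤-0≤ : ∀ {p q r s} → 0ℚ ≤ p → 0ℚ ≤ r → p ≤ q → r ≤ s → p * r ≤ q * s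
  *-mono-≤-0≤ {p} {q} {r} {s} 0≤p 0≤r p≤q r≤s =
    ≤-trans (*-monoʳ-≤-0≤ r 0≤r p≤q) (*-monoˡ-≤-0≤ q (≤-trans 0≤p p≤q) r≤s)

  p≤p+q : ∀ {p q} → 0ℚ ≤ q → p ≤ p + q
  p≤p+q {p} 0≤q = ≤-trans (≤-reflexive (sym (+-identityʳ p))) (+-monoʳ-≤ p 0≤q)

  p≤q⇒0≤q-p : ∀ {p q} → p ≤ q → 0ℚ ≤ q - p
  p≤q⇒0≤q-p {p} p≤q = ≤-trans (≤-reflexive (sym (+-inverseʳ p))) (+-monoˡ-≤ (- p) p≤q)

  p≤q⇒∣p-q∣≡q-p : ∀ {p q} → p ≤ q → ∣ p - q ∣ ≡ q - p
  p≤q⇒∣p-q∣≡q-p {p} {q} p≤q = begin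
    ∣ p - q ∣       ≡⟨ sym (∣-p∣≡∣p∣ (p - q)) ⟩
    ∣ - (p - q) ∣   ≡⟨ cong ∣_∣ (solve 2 (λ p q → :- (p :- q) := q :- p) refl p q) ⟩
    ∣ q - p ∣       ≡⟨ 0≤p⇒∣p∣≡p (p≤q⇒0≤q-p p≤q) ⟩
    q - p           ∎
    where open ≡-Reasoning

  p≤q+r⇒p-q≤r : ∀ {p q r} → p ≤ q + r → p - q ≤ r
  p≤q+r⇒p-q≤r {p} {q} {r} h =
    ≤-trans (+-monoˡ-≤ (- q) h) (≤-reflexive (solve 2 (λ q r → (q :+ r) :- q := r) refl q r))

  p≤∣p∣ : ∀ p → p ≤ ∣ p ∣
  p≤∣p∣ p with ∣p∣≡p∨∣p∣≡-p p
  ... | inj₁ e = ≤-reflexive (sym e)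
  ... | inj₂ e = ≤-trans p≤0 (0≤∣p∣ p)
    where
      p≤0 : p ≤ 0ℚ
      p≤0 = subst (_≤ 0ℚ) (solve 1 (λ x → :- (:- x) := x) refl p) (neg-antimono-≤ (subst (0ℚ ≤_) e (0≤∣p∣ p)))

  -∣p∣≤p : ∀ p → - ∣ p ∣ ≤ p
  -∣p∣≤p p = subst (_≤ p) (cong -_ (∣-p∣≡∣p∣ p))
    (subst (- ∣ - p ∣ ≤_) (solve 1 (λ x → :- (:- x) := x) refl p) (neg-antimono-≤ (p≤∣p∣ (- p))))

  ∣p∣≤q⇒-q≤p≤q : ∀ {p q} → ∣ p ∣ ≤ q → - q ≤ p × p ≤ q
  ∣p∣≤q⇒-q≤p≤q {p} ∣p∣≤q = ≤-trans (neg-antimono-≤ ∣p∣≤q) (-∣p∣≤p p) , ≤-trans (p≤∣p∣ p) ∣p∣≤q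

  ι-nonNeg : ∀ n → 0ℚ ≤ ι n
  ι-nonNeg zero = ≤-refl
  ι-nonNeg (suc n) = 0≤p+q 0≤1 (ι-nonNeg n)

  ι-mono : ∀ {m n} → m ℕ.≤ n → ι m ≤ ι n
  ι-mono {m} m≤n with ℕP.m≤n⇒∃[o]m+o≡n m≤n
  ... | o , refl = ≤-trans (p≤p+q (ι-nonNeg o)) (≤-reflexive (sym (ι-+ m o)))

  ι-suc-pos : ∀ n → 0ℚ < ι (suc n)
  ι-suc-pos n = <-≤-trans (toWitness {a? = 0ℚ <? 1ℚ} _) (p≤p+q (ι-nonNeg n))

  -- `recip 0 = 0`, so identities below that would involve 1/0 carry a hypothesis `1 ≤ n`.
  recip : ℕ → ℚ
  recip zero = 0ℚ
  recip (suc n) = 1/_ (ι (suc n)) {{>-nonZero (ι-suc-pos n)}}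

  ι*recip : ∀ n → ι (suc n) * recip (suc n) ≡ 1ℚ
  ι*recip n = *-inverseʳ (ι (suc n)) {{>-nonZero (ι-suc-pos n)}}

  ι*recip≤1 : ∀ n → ι n * recip n ≤ 1ℚ
  ι*recip≤1 zero = ≤-trans (≤-reflexive (*-zeroˡ 0ℚ)) 0≤1
  ι*recip≤1 (suc n) = ≤-reflexive (ι*recip n)

  recip*ι : ∀ n → recip (suc n) * ι (suc n) ≡ 1ℚ
  recip*ι n = trans (*-comm (recip (suc n)) (ι (suc n))) (ι*recip n)

  recip-unique : ∀ n x → ι (suc n) * x ≡ 1ℚ → x ≡ recip (suc n)
  recip-unique n x eq = begin
    x                                  ≡⟨ sym (*-identityˡ x) ⟩
    1ℚ * x                             ≡⟨ cong (_* x) (sym (recip*ι n)) ⟩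
    (recip (suc n) * ι (suc n)) * x    ≡⟨ *-assoc (recip (suc n)) (ι (suc n)) x ⟩
    recip (suc n) * (ι (suc n) * x)    ≡⟨ cong (recip (suc n) *_) eq ⟩
    recip (suc n) * 1ℚ                 ≡⟨ *-identityʳ _ ⟩
    recip (suc n)                      ∎
    where open ≡-Reasoning

  recip-* : ∀ m n → recip (m ℕ.* n) ≡ recip m * recip n
  recip-* zero n = sym (*-zeroˡ (recip n))
  recip-* (suc m) zero = trans (cong recip (ℕP.*-zeroʳ m)) (sym (*-zeroʳ (recip (suc m))))
  recip-* (suc m) (suc n) = sym (recip-unique (n ℕ.+ m ℕ.* suc n) (rm * rn) (begin
    ι (suc m ℕ.* suc n) * (rm * rn)  ≡⟨ cong (_* (rm * rn)) (ι-* (suc m) (suc n)) ⟩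
    (im * in′) * (rm * rn)           ≡⟨ solve 4 (λ a b c d → (a :* b) :* (c :* d) := (a :* c) :* (b :* d)) refl im in′ rm rn ⟩
    (im * rm) * (in′ * rn)           ≡⟨ cong₂ _*_ (ι*recip m) (ι*recip n) ⟩
    1ℚ * 1ℚ                          ≡⟨ *-identityˡ 1ℚ ⟩
    1ℚ                               ∎))
    where
      open ≡-Reasoning
      im = ι (suc m)
      in′ = ι (suc n)
      rm = recip (suc m)
      rn = recip (suc n)

  recip² recip³ : ℕ → ℚ
  recip² q = recip q * recip q
  recip³ q = recip q * recip q * recip q

  recip-nonNeg : ∀ n → 0ℚ ≤ recip n
  recip-nonNeg zero = ≤-refl
  recip-nonNeg (suc n) =
    <⇒≤ (positive⁻¹ (recip (suc n)) {{1/pos⇒pos (ι (suc n)) {{positive (ι-suc-pos n)}}}})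

  recip²-nonNeg : ∀ n → 0ℚ ≤ recip² n
  recip²-nonNeg n = 0≤p*q (recip-nonNeg n) (recip-nonNeg n)

  recip-antitone : ∀ {m n} → 1 ℕ.≤ m → m ℕ.≤ n → recip n ≤ recip m
  recip-antitone {suc m} {n} _ m≤n = begin
    recip n                                  ≡⟨ sym (*-identityʳ (recip n)) ⟩
    recip n * 1ℚ                             ≡⟨ cong (recip n *_) (sym (ι*recip m)) ⟩
    recip n * (ι (suc m) * recip (suc m))    ≡⟨ sym (*-assoc (recip n) _ _) ⟩
    (recip n * ι (suc m)) * recip (suc m)    ≤⟨ *-monoʳ-≤-0≤ (recip (suc m)) (recip-nonNeg (suc m))
                                                  (*-monoˡ-≤-0≤ (recip n) (recip-nonNeg n) (ι-mono m≤n)) ⟩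
    (recip n * ι n) * recip (suc m)          ≤⟨ *-monoʳ-≤-0≤ (recip (suc m)) (recip-nonNeg (suc m))
                                                  (≤-trans (≤-reflexive (*-comm (recip n) (ι n))) (ι*recip≤1 n)) ⟩
    1ℚ * recip (suc m)                       ≡⟨ *-identityˡ _ ⟩
    recip (suc m)                            ∎
    where open ≤-Reasoning

  recip-*≤ : ∀ m n → recip (m ℕ.* n) ≤ recip m
  recip-*≤ zero n = ≤-refl
  recip-*≤ (suc m) zero = ≤-trans (≤-reflexive (cong recip (ℕP.*-zeroʳ m))) (recip-nonNeg (suc m))
  recip-*≤ (suc m) (suc n) = recip-antitone (s≤s z≤n) (ℕP.m≤m*n (suc m) (suc n))

  recip-*³ : ∀ x y w → recip (x ℕ.* y ℕ.* w) ≡ recip x * recip y * recip w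
  recip-*³ x y w = trans (recip-* (x ℕ.* y) w) (cong (_* recip w) (recip-* x y))

  ∣u₁u₂u₃-v₁v₂v₃∣≤ : ∀ {u₁ u₂ u₃ v₁ v₂ v₃} → 0ℚ ≤ u₁ → 0ℚ ≤ u₂ → 0ℚ ≤ u₃ → u₁ ≤ v₁ → u₂ ≤ v₂ → u₃ ≤ v₃ →
    ∣ u₁ * u₂ * u₃ - v₁ * v₂ * v₃ ∣ ≤ (v₁ - u₁) * v₂ * v₃ + v₁ * (v₂ - u₂) * v₃ + v₁ * v₂ * (v₃ - u₃)
  ∣u₁u₂u₃-v₁v₂v₃∣≤ {u₁} {u₂} {u₃} {v₁} {v₂} {v₃} 0≤u₁ 0≤u₂ 0≤u₃ u₁≤v₁ u₂≤v₂ u₃≤v₃ = begin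
    ∣ u₁ * u₂ * u₃ - v₁ * v₂ * v₃ ∣
      ≡⟨ p≤q⇒∣p-q∣≡q-p u≤v ⟩
    v₁ * v₂ * v₃ - u₁ * u₂ * u₃
      ≡⟨ solve 6 (λ u₁ u₂ u₃ v₁ v₂ v₃ → v₁ :* v₂ :* v₃ :- u₁ :* u₂ :* u₃
           := (v₁ :- u₁) :* v₂ :* v₃ :+ u₁ :* (v₂ :- u₂) :* v₃ :+ u₁ :* u₂ :* (v₃ :- u₃)) refl u₁ u₂ u₃ v₁ v₂ v₃ ⟩
    (v₁ - u₁) * v₂ * v₃ + u₁ * (v₂ - u₂) * v₃ + u₁ * u₂ * (v₃ - u₃)
      ≤⟨ +-mono-≤ (+-monoʳ-≤ ((v₁ - u₁) * v₂ * v₃)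
           (*-monoʳ-≤-0≤ v₃ 0≤v₃ (*-monoʳ-≤-0≤ (v₂ - u₂) (p≤q⇒0≤q-p u₂≤v₂) u₁≤v₁)))
           (*-monoʳ-≤-0≤ (v₃ - u₃) (p≤q⇒0≤q-p u₃≤v₃) (*-mono-≤-0≤ 0≤u₁ 0≤u₂ u₁≤v₁ u₂≤v₂)) ⟩
    (v₁ - u₁) * v₂ * v₃ + v₁ * (v₂ - u₂) * v₃ + v₁ * v₂ * (v₃ - u₃) ∎
    where
      open ≤-Reasoning
      0≤v₃ = ≤-trans 0≤u₃ u₃≤v₃
      u≤v : u₁ * u₂ * u₃ ≤ v₁ * v₂ * v₃
      u≤v = *-mono-≤-0≤ (0≤p*q 0≤u₁ 0≤u₂) 0≤u₃ (*-mono-≤-0≤ 0≤u₁ 0≤u₂ u₁≤v₁ u₂≤v₂) u₃≤v₃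

module FiniteSums where

  open import Data.Nat as ℕ using (ℕ; zero; suc; s≤s; z≤n)
  import Data.Nat.Properties as ℕP
  open import Data.Rational.Base hiding (_/_)
  open import Data.Rational.Properties
  open import Data.Rational.Solver
  open import Data.List using (List; []; _∷_; _++_; map; downFrom; filter)
  open import Data.List.Properties using (filter-all; filter-accept; filter-reject)
  open import Data.List.Relation.Unary.All as All using (All; []; _∷_)
  import Data.List.Relation.Unary.All.Properties as AllP
  open import Data.List.Relation.Unary.Unique.Propositional using (Unique; []; _∷_)
  import Data.List.Relation.Unary.Unique.Propositional.Properties as UniqueP
  open import Data.Product using (_,_; _×_)
  open import Data.Empty using (⊥-elim)
  open import Relation.Nullary using (¬_; yes; no)
  open import Relation.Nullary.Decidable using (¬?)
  open import Relation.Unary using (Decidable)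
  open import Relation.Binary.PropositionalEquality
  open +-*-Solver
  open Rationals

  ∑ : ∀ {A : Set} → List A → (A → ℚ) → ℚ
  ∑ [] f = 0ℚ
  ∑ (x ∷ xs) f = f x + ∑ xs f

  ∏ : ∀ {A : Set} → List A → (A → ℚ) → ℚ
  ∏ [] f = 1ℚ
  ∏ (x ∷ xs) f = f x * ∏ xs f

  module _ {A : Set} where

    ∑-cong : ∀ (xs : List A) {f g} → (∀ x → f x ≡ g x) → ∑ xs f ≡ ∑ xs g
    ∑-cong [] eq = refl
    ∑-cong (x ∷ xs) eq = cong₂ _+_ (eq x) (∑-cong xs eq)

    ∑-+ : ∀ (xs : List A) f g → ∑ xs (λ x → f x + g x) ≡ ∑ xs f + ∑ xs g
    ∑-+ [] f g = sym (+-identityˡ 0ℚ)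
    ∑-+ (x ∷ xs) f g = trans (cong (f x + g x +_) (∑-+ xs f g))
      (solve 4 (λ a b c d → (a :+ b) :+ (c :+ d) := (a :+ c) :+ (b :+ d)) refl (f x) (g x) (∑ xs f) (∑ xs g))

    ∑-*ˡ : ∀ (xs : List A) c f → ∑ xs (λ x → c * f x) ≡ c * ∑ xs f
    ∑-*ˡ [] c f = sym (*-zeroʳ c)
    ∑-*ˡ (x ∷ xs) c f = trans (cong (c * f x +_) (∑-*ˡ xs c f)) (sym (*-distribˡ-+ c (f x) (∑ xs f)))

    ∑-*ʳ : ∀ (xs : List A) c f → ∑ xs (λ x → f x * c) ≡ ∑ xs f * c
    ∑-*ʳ [] c f = sym (*-zeroˡ c)
    ∑-*ʳ (x ∷ xs) c f = trans (cong (f x * c +_) (∑-*ʳ xs c f)) (sym (*-distribʳ-+ c (f x) (∑ xs f)))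

    ∑-neg : ∀ (xs : List A) f → ∑ xs (λ x → - f x) ≡ - ∑ xs f
    ∑-neg [] f = refl
    ∑-neg (x ∷ xs) f = trans (cong (- f x +_) (∑-neg xs f)) (sym (neg-distrib-+ (f x) (∑ xs f)))

    ∑-− : ∀ (xs : List A) f g → ∑ xs (λ x → f x - g x) ≡ ∑ xs f - ∑ xs g
    ∑-− xs f g = trans (∑-+ xs f (λ x → - g x)) (cong (∑ xs f +_) (∑-neg xs g))

    ∑-mono : ∀ (xs : List A) {f g} → (∀ x → f x ≤ g x) → ∑ xs f ≤ ∑ xs g
    ∑-mono [] le = ≤-refl
    ∑-mono (x ∷ xs) le = +-mono-≤ (le x) (∑-mono xs le)

    ∑-nonNeg : ∀ (xs : List A) {f} → (∀ x → 0ℚ ≤ f x) → 0ℚ ≤ ∑ xs f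
    ∑-nonNeg [] le = ≤-refl
    ∑-nonNeg (x ∷ xs) le = 0≤p+q (le x) (∑-nonNeg xs le)

    ∑-zero : ∀ (xs : List A) → ∑ xs (λ _ → 0ℚ) ≡ 0ℚ
    ∑-zero [] = refl
    ∑-zero (x ∷ xs) = trans (+-identityˡ _) (∑-zero xs)

    ∑-mono-All : ∀ {xs : List A} {f g} → All (λ x → f x ≤ g x) xs → ∑ xs f ≤ ∑ xs g
    ∑-mono-All [] = ≤-refl
    ∑-mono-All (fx≤gx ∷ rest) = +-mono-≤ fx≤gx (∑-mono-All rest)

    ∣∑∣≤∑∣∣ : ∀ (xs : List A) f → ∣ ∑ xs f ∣ ≤ ∑ xs (λ x → ∣ f x ∣)
    ∣∑∣≤∑∣∣ [] f = ≤-refl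
    ∣∑∣≤∑∣∣ (x ∷ xs) f = ≤-trans (∣p+q∣≤∣p∣+∣q∣ (f x) (∑ xs f)) (+-monoʳ-≤ ∣ f x ∣ (∣∑∣≤∑∣∣ xs f))

    ∑-++ : ∀ (xs ys : List A) f → ∑ (xs ++ ys) f ≡ ∑ xs f + ∑ ys f
    ∑-++ [] ys f = sym (+-identityˡ _)
    ∑-++ (x ∷ xs) ys f = trans (cong (f x +_) (∑-++ xs ys f)) (sym (+-assoc (f x) _ _))

    ∑-map : ∀ {B : Set} (xs : List B) (g : B → A) f → ∑ (map g xs) f ≡ ∑ xs (λ x → f (g x))
    ∑-map [] g f = refl
    ∑-map (x ∷ xs) g f = cong (f (g x) +_) (∑-map xs g f)

    ∏-cong : ∀ (xs : List A) {f g} → (∀ x → f x ≡ g x) → ∏ xs f ≡ ∏ xs g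
    ∏-cong [] eq = refl
    ∏-cong (x ∷ xs) eq = cong₂ _*_ (eq x) (∏-cong xs eq)

    ∏-* : ∀ (xs : List A) f g → ∏ xs (λ x → f x * g x) ≡ ∏ xs f * ∏ xs g
    ∏-* [] f g = sym (*-identityˡ 1ℚ)
    ∏-* (x ∷ xs) f g = trans (cong (f x * g x *_) (∏-* xs f g))
      (solve 4 (λ a b c d → (a :* b) :* (c :* d) := (a :* c) :* (b :* d)) refl (f x) (g x) (∏ xs f) (∏ xs g))

  ∑-comm : ∀ {A B : Set} (xs : List A) (ys : List B) (f : A → B → ℚ) →
           ∑ xs (λ x → ∑ ys (f x)) ≡ ∑ ys (λ y → ∑ xs (λ x → f x y))
  ∑-comm [] ys f = sym (∑-zero ys)
  ∑-comm (x ∷ xs) ys f = trans (cong (∑ ys (f x) +_) (∑-comm xs ys f)) (sym (∑-+ ys (f x) _))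

  downFrom₁ : ℕ → List ℕ
  downFrom₁ n = map suc (downFrom n)

  ∑≤ : ℕ → (ℕ → ℚ) → ℚ
  ∑≤ n = ∑ (downFrom₁ n)

  ∑≤-mono : ∀ N {f g : ℕ → ℚ} → (∀ y → 1 ℕ.≤ y → f y ≤ g y) → ∑≤ N f ≤ ∑≤ N g
  ∑≤-mono zero le = ≤-refl
  ∑≤-mono (suc N) le = +-mono-≤ (le (suc N) (s≤s z≤n)) (∑≤-mono N le)

  ∑≤-cong : ∀ N {f g : ℕ → ℚ} → (∀ y → 1 ℕ.≤ y → y ℕ.≤ N → f y ≡ g y) → ∑≤ N f ≡ ∑≤ N g
  ∑≤-cong zero eq = refl
  ∑≤-cong (suc N) eq =
    cong₂ _+_ (eq (suc N) (s≤s z≤n) ℕP.≤-refl) (∑≤-cong N (λ y 1≤y y≤N → eq y 1≤y (ℕP.m≤n⇒m≤1+n y≤N)))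

  ∑≤-nonNeg : ∀ N {f : ℕ → ℚ} → (∀ y → 0ℚ ≤ f y) → 0ℚ ≤ ∑≤ N f
  ∑≤-nonNeg N = ∑-nonNeg (downFrom₁ N)

  ∑≤-monoᴺ : ∀ {M N} (f : ℕ → ℚ) → (∀ y → 0ℚ ≤ f y) → M ℕ.≤ N → ∑≤ M f ≤ ∑≤ N f
  ∑≤-monoᴺ {M} {N} f 0≤f M≤N with ℕP.m≤n⇒∃[o]m+o≡n M≤N
  ... | o , refl = ≤-trans (extend o) (≤-reflexive (cong (λ t → ∑≤ t f) (ℕP.+-comm o M)))
    where
      extend : ∀ k → ∑≤ M f ≤ ∑≤ (k ℕ.+ M) f
      extend zero = ≤-refl
      extend (suc k) = ≤-trans (extend k) (≤-trans (≤-reflexive (sym (+-identityˡ _))) (+-monoˡ-≤ _ (0≤f (suc (k ℕ.+ M)))))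

  module _ (h : ℕ → ℚ) (0≤h : ∀ x → 0ℚ ≤ h x) where

    private
      ≢? : ∀ N → Decidable (_≢ N)
      ≢? N x = ¬? (x ℕ.≟ N)

      without : ℕ → List ℕ → List ℕ
      without N = filter (≢? N)

      ∑-without : ∀ N xs → Unique xs → ∑ xs h ≤ h N + ∑ (without N xs) h
      ∑-without N [] [] = ≤-trans (0≤h N) (≤-reflexive (sym (+-identityʳ (h N))))
      ∑-without N (x ∷ xs) (x∉xs ∷ uxs) with x ℕ.≟ N
      ... | yes refl = ≤-reflexive (cong (h x +_) (sym (trans (cong (λ ys → ∑ ys h) (filter-reject (≢? x) (λ x≢x → x≢x refl)))
                                                            (cong (λ ys → ∑ ys h) (filter-all (≢? x) (All.map (λ x≢y y≡x → x≢y (sym y≡x)) x∉xs))))))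
      ... | no x≢N = begin
        h x + ∑ xs h                         ≤⟨ +-monoʳ-≤ (h x) (∑-without N xs uxs) ⟩
        h x + (h N + ∑ (without N xs) h)     ≡⟨ solve 3 (λ a b c → a :+ (b :+ c) := b :+ (a :+ c)) refl (h x) (h N) _ ⟩
        h N + (h x + ∑ (without N xs) h)     ≡⟨ cong (λ ys → h N + ∑ ys h) (sym (filter-accept (≢? N) x≢N)) ⟩
        h N + ∑ (without N (x ∷ xs)) h       ∎
        where
          open ≤-Reasoning

    ∑-unique≤∑≤ : ∀ N xs → Unique xs → All (λ x → 1 ℕ.≤ x × x ℕ.≤ N) xs → ∑ xs h ≤ ∑≤ N h
    ∑-unique≤∑≤ zero [] _ _ = ≤-refl
    ∑-unique≤∑≤ zero (x ∷ xs) _ ((1≤x , x≤0) ∷ _) = ⊥-elim (ℕP.<⇒≱ 1≤x x≤0)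
    ∑-unique≤∑≤ (suc N) xs uxs bounded =
      ≤-trans (∑-without (suc N) xs uxs)
              (+-monoʳ-≤ (h (suc N)) (∑-unique≤∑≤ N (without (suc N) xs) (UniqueP.filter⁺ (≢? (suc N)) uxs)
                                        (All.zipWith lower (AllP.filter⁺ (≢? (suc N)) bounded , AllP.all-filter (≢? (suc N)) xs))))
      where
        lower : ∀ {x} → (1 ℕ.≤ x × x ℕ.≤ suc N) × ¬ (x ≡ suc N) → 1 ℕ.≤ x × x ℕ.≤ N
        lower ((1≤x , x≤1+N) , x≢1+N) = 1≤x , ℕP.≤-pred (ℕP.≤∧≢⇒< x≤1+N x≢1+N)

  ∑³ : ℕ → (ℕ → ℕ → ℕ → ℚ) → ℚ
  ∑³ H f = ∑≤ H (λ a → ∑≤ H (λ b → ∑≤ H (λ c → f a b c)))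

  module _ (H : ℕ) where

    ∑³-cong : ∀ {f g : ℕ → ℕ → ℕ → ℚ} → (∀ a b c → f a b c ≡ g a b c) → ∑³ H f ≡ ∑³ H g
    ∑³-cong eq = ∑-cong (downFrom₁ H) (λ a → ∑-cong (downFrom₁ H) (λ b → ∑-cong (downFrom₁ H) (eq a b)))

    ∑³-congᴴ : ∀ {f g : ℕ → ℕ → ℕ → ℚ} →
               (∀ a b c → 1 ℕ.≤ a → a ℕ.≤ H → 1 ℕ.≤ b → b ℕ.≤ H → f a b c ≡ g a b c) → ∑³ H f ≡ ∑³ H g
    ∑³-congᴴ eq = ∑≤-cong H (λ a 1≤a a≤H → ∑≤-cong H (λ b 1≤b b≤H → ∑-cong (downFrom₁ H) (λ c → eq a b c 1≤a a≤H 1≤b b≤H)))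

    ∑³-+ : ∀ (f g : ℕ → ℕ → ℕ → ℚ) → ∑³ H (λ a b c → f a b c + g a b c) ≡ ∑³ H f + ∑³ H g
    ∑³-+ f g = trans (∑-cong (downFrom₁ H) (λ a →
                 trans (∑-cong (downFrom₁ H) (λ b → ∑-+ (downFrom₁ H) (f a b) (g a b)))
                       (∑-+ (downFrom₁ H) _ _)))
               (∑-+ (downFrom₁ H) _ _)

    ∑³-*ˡ : ∀ k (f : ℕ → ℕ → ℕ → ℚ) → ∑³ H (λ a b c → k * f a b c) ≡ k * ∑³ H f
    ∑³-*ˡ k f = trans (∑-cong (downFrom₁ H) (λ a →
                  trans (∑-cong (downFrom₁ H) (λ b → ∑-*ˡ (downFrom₁ H) k (f a b)))
                        (∑-*ˡ (downFrom₁ H) k _)))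
                (∑-*ˡ (downFrom₁ H) k _)

    ∑³-combination : ∀ (k₁ k₂ k₃ k₄ : ℚ) (f₀ f₁ f₂ f₃ f₄ : ℕ → ℕ → ℕ → ℚ) →
      ∑³ H (λ a b c → f₀ a b c + k₁ * f₁ a b c + k₂ * f₂ a b c + k₃ * f₃ a b c + k₄ * f₄ a b c)
      ≡ ∑³ H f₀ + k₁ * ∑³ H f₁ + k₂ * ∑³ H f₂ + k₃ * ∑³ H f₃ + k₄ * ∑³ H f₄
    ∑³-combination k₁ k₂ k₃ k₄ f₀ f₁ f₂ f₃ f₄ =
      trans (∑³-+ _ (λ a b c → k₄ * f₄ a b c)) (cong₂ _+_
      (trans (∑³-+ _ (λ a b c → k₃ * f₃ a b c)) (cong₂ _+_
      (trans (∑³-+ _ (λ a b c → k₂ * f₂ a b c)) (cong₂ _+_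
      (trans (∑³-+ f₀ (λ a b c → k₁ * f₁ a b c)) (cong (∑³ H f₀ +_) (∑³-*ˡ k₁ f₁)))
      (∑³-*ˡ k₂ f₂))) (∑³-*ˡ k₃ f₃))) (∑³-*ˡ k₄ f₄))

    ∑³-separable : ∀ (f g h : ℕ → ℚ) → ∑³ H (λ a b c → f a * g b * h c) ≡ ∑≤ H f * ∑≤ H g * ∑≤ H h
    ∑³-separable f g h = begin
      ∑≤ H (λ a → ∑≤ H (λ b → ∑≤ H (λ c → f a * g b * h c)))
        ≡⟨ ∑-cong (downFrom₁ H) (λ a → ∑-cong (downFrom₁ H) (λ b → ∑-*ˡ (downFrom₁ H) (f a * g b) h)) ⟩
      ∑≤ H (λ a → ∑≤ H (λ b → f a * g b * ∑≤ H h))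
        ≡⟨ ∑-cong (downFrom₁ H) (λ a → trans (∑-*ʳ (downFrom₁ H) (∑≤ H h) (λ b → f a * g b))
                                              (cong (_* ∑≤ H h) (∑-*ˡ (downFrom₁ H) (f a) g))) ⟩
      ∑≤ H (λ a → f a * ∑≤ H g * ∑≤ H h)
        ≡⟨ trans (∑-*ʳ (downFrom₁ H) (∑≤ H h) (λ a → f a * ∑≤ H g)) (cong (_* ∑≤ H h) (∑-*ʳ (downFrom₁ H) (∑≤ H g) f)) ⟩
      ∑≤ H f * ∑≤ H g * ∑≤ H h ∎
      where open ≡-Reasoning

    ∑³-∑ : ∀ {A : Set} (xs : List A) (g : A → ℕ → ℕ → ℕ → ℚ) →
           ∑³ H (λ a b c → ∑ xs (λ x → g x a b c)) ≡ ∑ xs (λ x → ∑³ H (g x))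
    ∑³-∑ xs g = begin
      ∑≤ H (λ a → ∑≤ H (λ b → ∑≤ H (λ c → ∑ xs (λ x → g x a b c))))
        ≡⟨ ∑-cong (downFrom₁ H) (λ a → ∑-cong (downFrom₁ H) (λ b → ∑-comm (downFrom₁ H) xs (λ c x → g x a b c))) ⟩
      ∑≤ H (λ a → ∑≤ H (λ b → ∑ xs (λ x → ∑≤ H (g x a b))))
        ≡⟨ ∑-cong (downFrom₁ H) (λ a → ∑-comm (downFrom₁ H) xs (λ b x → ∑≤ H (g x a b))) ⟩
      ∑≤ H (λ a → ∑ xs (λ x → ∑≤ H (λ b → ∑≤ H (g x a b))))
        ≡⟨ ∑-comm (downFrom₁ H) xs (λ a x → ∑≤ H (λ b → ∑≤ H (g x a b))) ⟩
      ∑ xs (λ x → ∑³ H (g x)) ∎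
      where open ≡-Reasoning

module Divisibility where

  open import Data.Nat as ℕ using (ℕ)
  import Data.Nat.Properties as ℕP
  open import Data.Nat.Divisibility
  open import Data.Nat.Primality
  open import Data.Bool using (Bool; true; false)
  open import Data.Rational.Base using (ℚ; 0ℚ; 1ℚ; _*_)
  open import Data.Rational.Properties using (*-zeroˡ; *-zeroʳ)
  open import Data.Sum using (inj₁; inj₂)
  open import Data.Empty using (⊥-elim)
  open import Relation.Nullary using (¬_; yes; no)
  open import Relation.Nullary.Decidable using (isYes)
  open import Relation.Binary.PropositionalEquality

  prime∤1 : ∀ {p} → Prime p → ¬ (p ∣ 1)
  prime∤1 pp p∣1 with ∣1⇒≡1 p∣1
  ... | refl = ¬prime[1] pp

  prime∣prime⇒≡ : ∀ {p q} → Prime p → Prime q → p ∣ q → p ≡ q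
  prime∣prime⇒≡ pp pq p∣q with prime⇒irreducible pq p∣q
  ... | inj₁ refl = ⊥-elim (¬prime[1] pp)
  ... | inj₂ p≡q = p≡q

  prime∤* : ∀ {p m n} → Prime p → ¬ (p ∣ m) → ¬ (p ∣ n) → ¬ (p ∣ m ℕ.* n)
  prime∤* {m = m} {n} pp p∤m p∤n p∣mn with euclidsLemma m n pp p∣mn
  ... | inj₁ p∣m = p∤m p∣m
  ... | inj₂ p∣n = p∤n p∣n

  prime∤⇒*∣ : ∀ {q m a} → Prime q → ¬ (q ∣ m) → m ∣ a → q ∣ a → q ℕ.* m ∣ a
  prime∤⇒*∣ {q} {m} pq q∤m (divides k refl) q∣km with euclidsLemma k m pq q∣km
  ... | inj₂ q∣m = ⊥-elim (q∤m q∣m)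
  ... | inj₁ (divides j refl) = divides j (ℕP.*-assoc j q m)

  χ : Bool → ℚ
  χ true = 1ℚ
  χ false = 0ℚ

  𝟙[_∣_] : ℕ → ℕ → ℚ
  𝟙[ d ∣ a ] = χ (isYes (d ∣? a))

  𝟙∣-yes : ∀ {d a} → d ∣ a → 𝟙[ d ∣ a ] ≡ 1ℚ
  𝟙∣-yes {d} {a} d∣a with d ∣? a
  ... | yes _ = refl
  ... | no d∤a = ⊥-elim (d∤a d∣a)

  𝟙∣-no : ∀ {d a} → ¬ (d ∣ a) → 𝟙[ d ∣ a ] ≡ 0ℚ
  𝟙∣-no {d} {a} d∤a with d ∣? a
  ... | yes d∣a = ⊥-elim (d∤a d∣a)
  ... | no _ = refl

  𝟙∣-*-prime : ∀ {q m} a → Prime q → ¬ (q ∣ m) → 𝟙[ m ∣ a ] * 𝟙[ q ∣ a ] ≡ 𝟙[ q ℕ.* m ∣ a ]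
  𝟙∣-*-prime {q} {m} a pq q∤m with m ∣? a | q ∣? a
  ... | yes m∣a | yes q∣a = sym (𝟙∣-yes (prime∤⇒*∣ pq q∤m m∣a q∣a))
  ... | yes _   | no q∤a  = trans (*-zeroʳ 1ℚ) (sym (𝟙∣-no (λ qm∣a → q∤a (m*n∣⇒m∣ q m qm∣a))))
  ... | no m∤a  | q∣?a    = trans (*-zeroˡ (χ (isYes q∣?a))) (sym (𝟙∣-no (λ qm∣a → m∤a (m*n∣⇒n∣ q m qm∣a))))

module EulerExpansion where

  open import Data.Nat as ℕ using (ℕ; zero; suc)
  import Data.Nat.Properties as ℕP
  open import Data.Nat.Divisibility using (_∣_; ∣⇒≤; ∣m+n∣m⇒∣n; n∣m*n; 0∣⇒≡0)
  open import Data.Nat.DivMod using (_/_; _%_; m≡m%n+[m/n]*n; m%n<n)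
  open import Data.Nat.Primality using (Prime)
  open import Data.Nat.Tactic.RingSolver using (solve-∀)
  open import Data.Rational.Base hiding (_/_)
  open import Data.Rational.Properties
  open import Data.Rational.Solver
  open import Data.List using (List; []; _∷_)
  open import Data.List.Relation.Unary.All as All using (All; []; _∷_)
  open import Data.List.Relation.Unary.Unique.Propositional using (Unique; []; _∷_)
  open import Data.Product using (_,_; _×_)
  open import Relation.Nullary using (¬_)
  open import Relation.Binary.PropositionalEquality
  open +-*-Solver
  open Rationals
  open FiniteSums
  open Divisibility

  -- Records how the primes of an expanded Euler product are distributed: those in X divide a and b,
  -- those in Y divide a and c, those in Z divide b and c, and those in W divide a, b and c.
  record Pattern : Set where
    constructor mkPattern
    field X Y Z W : ℕ
  open Pattern public

  unitPattern : Pattern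
  unitPattern = mkPattern 1 1 1 1

  dᵃ dᵇ dᶜ : Pattern → ℕ
  dᵃ s = X s ℕ.* Y s ℕ.* W s
  dᵇ s = X s ℕ.* Z s ℕ.* W s
  dᶜ s = Y s ℕ.* Z s ℕ.* W s

  pushX pushY pushZ pushW : ℕ → Pattern → Pattern
  pushX q (mkPattern x y z w) = mkPattern (q ℕ.* x) y z w
  pushY q (mkPattern x y z w) = mkPattern x (q ℕ.* y) z w
  pushZ q (mkPattern x y z w) = mkPattern x y (q ℕ.* z) w
  pushW q (mkPattern x y z w) = mkPattern x y z (q ℕ.* w)

  private
    front₁ : ∀ q x y w → q ℕ.* x ℕ.* y ℕ.* w ≡ q ℕ.* (x ℕ.* y ℕ.* w)
    front₁ = solve-∀
    front₂ : ∀ q x y w → x ℕ.* (q ℕ.* y) ℕ.* w ≡ q ℕ.* (x ℕ.* y ℕ.* w)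
    front₂ = solve-∀
    front₃ : ∀ q x y w → x ℕ.* y ℕ.* (q ℕ.* w) ≡ q ℕ.* (x ℕ.* y ℕ.* w)
    front₃ = solve-∀

  module _ (q : ℕ) where
    dᵃ-pushX : ∀ s → dᵃ (pushX q s) ≡ q ℕ.* dᵃ s
    dᵃ-pushX (mkPattern x y z w) = front₁ q x y w
    dᵇ-pushX : ∀ s → dᵇ (pushX q s) ≡ q ℕ.* dᵇ s
    dᵇ-pushX (mkPattern x y z w) = front₁ q x z w
    dᵃ-pushY : ∀ s → dᵃ (pushY q s) ≡ q ℕ.* dᵃ s
    dᵃ-pushY (mkPattern x y z w) = front₂ q x y w
    dᶜ-pushY : ∀ s → dᶜ (pushY q s) ≡ q ℕ.* dᶜ s
    dᶜ-pushY (mkPattern x y z w) = front₁ q y z w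
    dᵇ-pushZ : ∀ s → dᵇ (pushZ q s) ≡ q ℕ.* dᵇ s
    dᵇ-pushZ (mkPattern x y z w) = front₂ q x z w
    dᶜ-pushZ : ∀ s → dᶜ (pushZ q s) ≡ q ℕ.* dᶜ s
    dᶜ-pushZ (mkPattern x y z w) = front₂ q y z w
    dᵃ-pushW : ∀ s → dᵃ (pushW q s) ≡ q ℕ.* dᵃ s
    dᵃ-pushW (mkPattern x y z w) = front₃ q x y w
    dᵇ-pushW : ∀ s → dᵇ (pushW q s) ≡ q ℕ.* dᵇ s
    dᵇ-pushW (mkPattern x y z w) = front₃ q x z w
    dᶜ-pushW : ∀ s → dᶜ (pushW q s) ≡ q ℕ.* dᶜ s
    dᶜ-pushW (mkPattern x y z w) = front₃ q y z w

  record Coeffs : Set where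
    constructor coeffs
    field cX cY cZ cW : ℚ
  open Coeffs public

  localFactor : Coeffs → ℕ → ℕ → ℕ → ℕ → ℚ
  localFactor l p a b c = 1ℚ + cX l * (𝟙[ p ∣ a ] * 𝟙[ p ∣ b ]) + cY l * (𝟙[ p ∣ a ] * 𝟙[ p ∣ c ])
                             + cZ l * (𝟙[ p ∣ b ] * 𝟙[ p ∣ c ]) + cW l * (𝟙[ p ∣ a ] * 𝟙[ p ∣ b ] * 𝟙[ p ∣ c ])

  expand : Coeffs → List ℕ → (Pattern → ℚ) → Pattern → ℚ
  expand l [] f s = f s
  expand l (q ∷ L) f s = expand l L f s + cX l * expand l L f (pushX q s) + cY l * expand l L f (pushY q s)
                         + cZ l * expand l L f (pushZ q s) + cW l * expand l L f (pushW q s)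

  fits : Pattern → ℕ → ℕ → ℕ → ℚ
  fits s a b c = 𝟙[ dᵃ s ∣ a ] * 𝟙[ dᵇ s ∣ b ] * 𝟙[ dᶜ s ∣ c ]

  Fresh : Pattern → ℕ → Set
  Fresh s p = ¬ (p ∣ dᵃ s) × ¬ (p ∣ dᵇ s) × ¬ (p ∣ dᶜ s)

  module _ {q : ℕ} (pq : Prime q) where

    private
      𝟙-push : ∀ {m m′} a → ¬ (q ∣ m) → m′ ≡ q ℕ.* m → 𝟙[ m′ ∣ a ] ≡ 𝟙[ m ∣ a ] * 𝟙[ q ∣ a ]
      𝟙-push a q∤m refl = sym (𝟙∣-*-prime a pq q∤m)

    fits-pushX : ∀ s a b c → Fresh s q → fits (pushX q s) a b c ≡ fits s a b c * (𝟙[ q ∣ a ] * 𝟙[ q ∣ b ])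
    fits-pushX s@(mkPattern _ _ _ _) a b c (q∤dᵃ , q∤dᵇ , _) =
      trans (cong₂ (λ u v → u * v * 𝟙[ dᶜ s ∣ c ]) (𝟙-push a q∤dᵃ (dᵃ-pushX q s)) (𝟙-push b q∤dᵇ (dᵇ-pushX q s)))
            (solve 5 (λ u v w x y → (u :* x) :* (v :* y) :* w := u :* v :* w :* (x :* y)) refl
                     𝟙[ dᵃ s ∣ a ] 𝟙[ dᵇ s ∣ b ] 𝟙[ dᶜ s ∣ c ] 𝟙[ q ∣ a ] 𝟙[ q ∣ b ])

    fits-pushY : ∀ s a b c → Fresh s q → fits (pushY q s) a b c ≡ fits s a b c * (𝟙[ q ∣ a ] * 𝟙[ q ∣ c ])
    fits-pushY s@(mkPattern _ _ _ _) a b c (q∤dᵃ , _ , q∤dᶜ) =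
      trans (cong₂ (λ u w → u * 𝟙[ dᵇ s ∣ b ] * w) (𝟙-push a q∤dᵃ (dᵃ-pushY q s)) (𝟙-push c q∤dᶜ (dᶜ-pushY q s)))
            (solve 5 (λ u v w x z → (u :* x) :* v :* (w :* z) := u :* v :* w :* (x :* z)) refl
                     𝟙[ dᵃ s ∣ a ] 𝟙[ dᵇ s ∣ b ] 𝟙[ dᶜ s ∣ c ] 𝟙[ q ∣ a ] 𝟙[ q ∣ c ])

    fits-pushZ : ∀ s a b c → Fresh s q → fits (pushZ q s) a b c ≡ fits s a b c * (𝟙[ q ∣ b ] * 𝟙[ q ∣ c ])
    fits-pushZ s@(mkPattern _ _ _ _) a b c (_ , q∤dᵇ , q∤dᶜ) =
      trans (cong₂ (λ v w → 𝟙[ dᵃ s ∣ a ] * v * w) (𝟙-push b q∤dᵇ (dᵇ-pushZ q s)) (𝟙-push c q∤dᶜ (dᶜ-pushZ q s)))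
            (solve 5 (λ u v w y z → u :* (v :* y) :* (w :* z) := u :* v :* w :* (y :* z)) refl
                     𝟙[ dᵃ s ∣ a ] 𝟙[ dᵇ s ∣ b ] 𝟙[ dᶜ s ∣ c ] 𝟙[ q ∣ b ] 𝟙[ q ∣ c ])

    fits-pushW : ∀ s a b c → Fresh s q →
                 fits (pushW q s) a b c ≡ fits s a b c * (𝟙[ q ∣ a ] * 𝟙[ q ∣ b ] * 𝟙[ q ∣ c ])
    fits-pushW s@(mkPattern _ _ _ _) a b c (q∤dᵃ , q∤dᵇ , q∤dᶜ) =
      trans (cong₂ _*_ (cong₂ _*_ (𝟙-push a q∤dᵃ (dᵃ-pushW q s)) (𝟙-push b q∤dᵇ (dᵇ-pushW q s)))
                       (𝟙-push c q∤dᶜ (dᶜ-pushW q s)))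
            (solve 6 (λ u v w x y z → (u :* x) :* (v :* y) :* (w :* z) := u :* v :* w :* (x :* y :* z)) refl
                     𝟙[ dᵃ s ∣ a ] 𝟙[ dᵇ s ∣ b ] 𝟙[ dᶜ s ∣ c ] 𝟙[ q ∣ a ] 𝟙[ q ∣ b ] 𝟙[ q ∣ c ])

    private
      distribute : ∀ (F x y z kX kY kZ kW P : ℚ) →
        F * ((1ℚ + kX * (x * y) + kY * (x * z) + kZ * (y * z) + kW * (x * y * z)) * P)
        ≡ F * P + kX * (F * (x * y) * P) + kY * (F * (x * z) * P) + kZ * (F * (y * z) * P) + kW * (F * (x * y * z) * P)
      distribute = solve 9 (λ F x y z kX kY kZ kW P →
        F :* ((con 1ℚ :+ kX :* (x :* y) :+ kY :* (x :* z) :+ kZ :* (y :* z) :+ kW :* (x :* y :* z)) :* P)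
        := F :* P :+ kX :* (F :* (x :* y) :* P) :+ kY :* (F :* (x :* z) :* P)
           :+ kZ :* (F :* (y :* z) :* P) :+ kW :* (F :* (x :* y :* z) :* P)) refl

    fits*localFactor : ∀ l s a b c P → Fresh s q →
      fits s a b c * (localFactor l q a b c * P)
        ≡ fits s a b c * P + cX l * (fits (pushX q s) a b c * P) + cY l * (fits (pushY q s) a b c * P)
          + cZ l * (fits (pushZ q s) a b c * P) + cW l * (fits (pushW q s) a b c * P)
    fits*localFactor l s a b c P fresh =
      trans (distribute (fits s a b c) 𝟙[ q ∣ a ] 𝟙[ q ∣ b ] 𝟙[ q ∣ c ] (cX l) (cY l) (cZ l) (cW l) P)
            (cong₂ _+_ (cong₂ _+_ (cong₂ _+_ (cong (fits s a b c * P +_)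
              (branch (cX l) (fits-pushX s a b c fresh))) (branch (cY l) (fits-pushY s a b c fresh)))
              (branch (cZ l) (fits-pushZ s a b c fresh))) (branch (cW l) (fits-pushW s a b c fresh)))
      where
        branch : ∀ k {u v} → u ≡ v → k * (v * P) ≡ k * (u * P)
        branch k eq = cong (λ t → k * (t * P)) (sym eq)

  module _ {p q} (pp : Prime p) (pq : Prime q) (q≢p : q ≢ p) where

    private
      p∤q* : ∀ {m m′} → ¬ (p ∣ m) → m′ ≡ q ℕ.* m → ¬ (p ∣ m′)
      p∤q* p∤m refl = prime∤* pp (λ p∣q → q≢p (sym (prime∣prime⇒≡ pp pq p∣q))) p∤m

    fresh-pushX : ∀ s → Fresh s p → Fresh (pushX q s) p
    fresh-pushX s@(mkPattern _ _ _ _) (p∤dᵃ , p∤dᵇ , p∤dᶜ) = p∤q* p∤dᵃ (dᵃ-pushX q s) , p∤q* p∤dᵇ (dᵇ-pushX q s) , p∤dᶜ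

    fresh-pushY : ∀ s → Fresh s p → Fresh (pushY q s) p
    fresh-pushY s@(mkPattern _ _ _ _) (p∤dᵃ , p∤dᵇ , p∤dᶜ) = p∤q* p∤dᵃ (dᵃ-pushY q s) , p∤dᵇ , p∤q* p∤dᶜ (dᶜ-pushY q s)

    fresh-pushZ : ∀ s → Fresh s p → Fresh (pushZ q s) p
    fresh-pushZ s@(mkPattern _ _ _ _) (p∤dᵃ , p∤dᵇ , p∤dᶜ) = p∤dᵃ , p∤q* p∤dᵇ (dᵇ-pushZ q s) , p∤q* p∤dᶜ (dᶜ-pushZ q s)

    fresh-pushW : ∀ s → Fresh s p → Fresh (pushW q s) p
    fresh-pushW s@(mkPattern _ _ _ _) (p∤dᵃ , p∤dᵇ , p∤dᶜ) =
      p∤q* p∤dᵃ (dᵃ-pushW q s) , p∤q* p∤dᵇ (dᵇ-pushW q s) , p∤q* p∤dᶜ (dᶜ-pushW q s)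

  ∑³-fits*∏localFactor : ∀ l H L s → All Prime L → Unique L → All (Fresh s) L →
    ∑³ H (λ a b c → fits s a b c * ∏ L (λ p → localFactor l p a b c)) ≡ expand l L (λ t → ∑³ H (fits t)) s
  ∑³-fits*∏localFactor l H [] s _ _ _ = ∑³-cong H (λ a b c → *-identityʳ _)
  ∑³-fits*∏localFactor l H (q ∷ L) s (pq ∷ pL) (q∉L ∷ uL) (fresh ∷ freshL) = begin
    ∑³ H (λ a b c → fits s a b c * (localFactor l q a b c * P a b c))
      ≡⟨ ∑³-cong H (λ a b c → fits*localFactor pq l s a b c (P a b c) fresh) ⟩
    ∑³ H (λ a b c → fits s a b c * P a b c + cX l * (fits (pushX q s) a b c * P a b c)
         + cY l * (fits (pushY q s) a b c * P a b c) + cZ l * (fits (pushZ q s) a b c * P a b c)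
         + cW l * (fits (pushW q s) a b c * P a b c))
      ≡⟨ ∑³-combination H (cX l) (cY l) (cZ l) (cW l) (fitsP s) (fitsP (pushX q s)) (fitsP (pushY q s))
                          (fitsP (pushZ q s)) (fitsP (pushW q s)) ⟩
    ∑³ H (fitsP s) + cX l * ∑³ H (fitsP (pushX q s)) + cY l * ∑³ H (fitsP (pushY q s))
      + cZ l * ∑³ H (fitsP (pushZ q s)) + cW l * ∑³ H (fitsP (pushW q s))
      ≡⟨ cong₂ _+_ (cong₂ _+_ (cong₂ _+_ (cong₂ _+_ (ih s freshL)
           (cong (cX l *_) (ih (pushX q s) (pushed pushX fresh-pushX))))
           (cong (cY l *_) (ih (pushY q s) (pushed pushY fresh-pushY))))
           (cong (cZ l *_) (ih (pushZ q s) (pushed pushZ fresh-pushZ))))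
           (cong (cW l *_) (ih (pushW q s) (pushed pushW fresh-pushW))) ⟩
    expand l (q ∷ L) (λ t → ∑³ H (fits t)) s ∎
    where
      open ≡-Reasoning
      P : ℕ → ℕ → ℕ → ℚ
      P a b c = ∏ L (λ p → localFactor l p a b c)
      fitsP : Pattern → ℕ → ℕ → ℕ → ℚ
      fitsP t a b c = fits t a b c * P a b c
      ih : ∀ t → All (Fresh t) L → ∑³ H (fitsP t) ≡ expand l L (λ t′ → ∑³ H (fits t′)) t
      ih t = ∑³-fits*∏localFactor l H L t pL uL
      pushed : ∀ (push : ℕ → Pattern → Pattern) →
               (∀ {p} → Prime p → Prime q → q ≢ p → ∀ s → Fresh s p → Fresh (push q s) p) → All (Fresh (push q s)) L
      pushed _ step = All.zipWith (λ (pp , q≢p , fr) → step pp pq q≢p s fr) (pL , All.zip (q∉L , freshL))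

  multiplesUpTo : ℕ → ℕ → ℕ
  multiplesUpTo H zero = 0
  multiplesUpTo H (suc d) = H / suc d

  private
    ∑≤-𝟙∣-divMod : ∀ e n q r → r ℕ.< suc e → n ≡ r ℕ.+ q ℕ.* suc e → ∑≤ n (λ a → 𝟙[ suc e ∣ a ]) ≡ ι q
    ∑≤-𝟙∣-divMod e zero zero zero _ _ = refl
    ∑≤-𝟙∣-divMod e zero zero (suc r) _ ()
    ∑≤-𝟙∣-divMod e zero (suc q) r _ eq with trans eq (ℕP.+-suc r (e ℕ.+ q ℕ.* suc e))
    ... | ()
    ∑≤-𝟙∣-divMod e (suc n) q (suc r) r<d eq =
      trans (cong₂ _+_ (𝟙∣-no d∤) (∑≤-𝟙∣-divMod e n q r (ℕP.<-trans (ℕP.n<1+n r) r<d) (ℕP.suc-injective eq)))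
            (+-identityˡ (ι q))
      where
        d∤ : ¬ (suc e ∣ suc n)
        d∤ d∣ = ℕP.<⇒≱ r<d (∣⇒≤ (∣m+n∣m⇒∣n (subst (suc e ∣_) (trans eq (ℕP.+-comm (suc r) (q ℕ.* suc e))) d∣) (n∣m*n q)))
    ∑≤-𝟙∣-divMod e (suc n) zero zero _ ()
    ∑≤-𝟙∣-divMod e (suc n) (suc q) zero _ eq =
      cong₂ _+_ (𝟙∣-yes (subst (suc e ∣_) (sym eq) (n∣m*n (suc q))))
                (∑≤-𝟙∣-divMod e n q e (ℕP.n<1+n e) (ℕP.suc-injective eq))

  ∑≤-𝟙∣ : ∀ H d → ∑≤ H (λ a → 𝟙[ d ∣ a ]) ≡ ι (multiplesUpTo H d)
  ∑≤-𝟙∣ zero zero = refl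
  ∑≤-𝟙∣ (suc H) zero = trans (cong₂ _+_ (𝟙∣-no 0∤) (∑≤-𝟙∣ H zero)) (+-identityˡ 0ℚ)
    where
      0∤ : ¬ (0 ∣ suc H)
      0∤ 0∣ with 0∣⇒≡0 0∣
      ... | ()
  ∑≤-𝟙∣ H (suc e) = ∑≤-𝟙∣-divMod e H (H / suc e) (H % suc e) (m%n<n H (suc e)) (m≡m%n+[m/n]*n H (suc e))

  lattice : ℕ → Pattern → ℚ
  lattice H s = ι (multiplesUpTo H (dᵃ s)) * ι (multiplesUpTo H (dᵇ s)) * ι (multiplesUpTo H (dᶜ s))

  ∑³-fits : ∀ H s → ∑³ H (fits s) ≡ lattice H s
  ∑³-fits H s = trans (∑³-separable H (λ a → 𝟙[ dᵃ s ∣ a ]) (λ b → 𝟙[ dᵇ s ∣ b ]) (λ c → 𝟙[ dᶜ s ∣ c ]))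
     (cong₂ _*_ (cong₂ _*_ (∑≤-𝟙∣ H (dᵃ s)) (∑≤-𝟙∣ H (dᵇ s))) (∑≤-𝟙∣ H (dᶜ s)))

  volume : ℕ → Pattern → ℚ
  volume H s = (ι H * recip (dᵃ s)) * (ι H * recip (dᵇ s)) * (ι H * recip (dᶜ s))

  localDensity : Coeffs → ℕ → ℚ
  localDensity l q = 1ℚ + cX l * recip² q + cY l * recip² q + cZ l * recip² q + cW l * recip³ q

  module _ (H q : ℕ) where

    private
      recip-push : ∀ {m m′} → m′ ≡ q ℕ.* m → ι H * recip m′ ≡ recip q * (ι H * recip m)
      recip-push {m} refl = trans (cong (ι H *_) (recip-* q m))
        (solve 3 (λ h x y → h :* (x :* y) := x :* (h :* y)) refl (ι H) (recip q) (recip m))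

    volume-pushX : ∀ s → volume H (pushX q s) ≡ volume H s * recip² q
    volume-pushX s@(mkPattern _ _ _ _) =
      trans (cong₂ (λ u v → u * v * (ι H * recip (dᶜ s))) (recip-push (dᵃ-pushX q s)) (recip-push (dᵇ-pushX q s)))
            (solve 4 (λ r u v w → (r :* u) :* (r :* v) :* w := u :* v :* w :* (r :* r)) refl
                     (recip q) (ι H * recip (dᵃ s)) (ι H * recip (dᵇ s)) (ι H * recip (dᶜ s)))

    volume-pushY : ∀ s → volume H (pushY q s) ≡ volume H s * recip² q
    volume-pushY s@(mkPattern _ _ _ _) =
      trans (cong₂ (λ u w → u * (ι H * recip (dᵇ s)) * w) (recip-push (dᵃ-pushY q s)) (recip-push (dᶜ-pushY q s)))
            (solve 4 (λ r u v w → (r :* u) :* v :* (r :* w) := u :* v :* w :* (r :* r)) refl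
                     (recip q) (ι H * recip (dᵃ s)) (ι H * recip (dᵇ s)) (ι H * recip (dᶜ s)))

    volume-pushZ : ∀ s → volume H (pushZ q s) ≡ volume H s * recip² q
    volume-pushZ s@(mkPattern _ _ _ _) =
      trans (cong₂ (λ v w → (ι H * recip (dᵃ s)) * v * w) (recip-push (dᵇ-pushZ q s)) (recip-push (dᶜ-pushZ q s)))
            (solve 4 (λ r u v w → u :* (r :* v) :* (r :* w) := u :* v :* w :* (r :* r)) refl
                     (recip q) (ι H * recip (dᵃ s)) (ι H * recip (dᵇ s)) (ι H * recip (dᶜ s)))

    volume-pushW : ∀ s → volume H (pushW q s) ≡ volume H s * recip³ q
    volume-pushW s@(mkPattern _ _ _ _) =
      trans (cong₂ _*_ (cong₂ _*_ (recip-push (dᵃ-pushW q s)) (recip-push (dᵇ-pushW q s))) (recip-push (dᶜ-pushW q s)))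
            (solve 4 (λ r u v w → (r :* u) :* (r :* v) :* (r :* w) := u :* v :* w :* (r :* r :* r)) refl
                     (recip q) (ι H * recip (dᵃ s)) (ι H * recip (dᵇ s)) (ι H * recip (dᶜ s)))

  expand-multiplicative : ∀ l L (g : Pattern → ℚ) →
    (∀ q s → g (pushX q s) ≡ g s * recip² q) → (∀ q s → g (pushY q s) ≡ g s * recip² q) →
    (∀ q s → g (pushZ q s) ≡ g s * recip² q) → (∀ q s → g (pushW q s) ≡ g s * recip³ q) →
    ∀ s → expand l L g s ≡ g s * ∏ L (localDensity l)
  expand-multiplicative l [] g _ _ _ _ s = sym (*-identityʳ (g s))
  expand-multiplicative l (q ∷ L) g gX gY gZ gW s = begin
    E s + cX l * E (pushX q s) + cY l * E (pushY q s) + cZ l * E (pushZ q s) + cW l * E (pushW q s)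
      ≡⟨ cong₂ _+_ (cong₂ _+_ (cong₂ _+_ (cong₂ _+_ (ih s) (cong (cX l *_) (ih (pushX q s))))
                   (cong (cY l *_) (ih (pushY q s)))) (cong (cZ l *_) (ih (pushZ q s)))) (cong (cW l *_) (ih (pushW q s))) ⟩
    g s * P + cX l * (g (pushX q s) * P) + cY l * (g (pushY q s) * P) + cZ l * (g (pushZ q s) * P) + cW l * (g (pushW q s) * P)
      ≡⟨ cong₂ _+_ (cong₂ _+_ (cong₂ _+_ (cong (g s * P +_) (cong (λ t → cX l * (t * P)) (gX q s)))
                   (cong (λ t → cY l * (t * P)) (gY q s))) (cong (λ t → cZ l * (t * P)) (gZ q s)))
                   (cong (λ t → cW l * (t * P)) (gW q s)) ⟩
    g s * P + cX l * (g s * recip² q * P) + cY l * (g s * recip² q * P) + cZ l * (g s * recip² q * P) + cW l * (g s * recip³ q * P)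
      ≡⟨ solve 8 (λ G P a b c d u v → G :* P :+ a :* (G :* u :* P) :+ b :* (G :* u :* P) :+ c :* (G :* u :* P) :+ d :* (G :* v :* P)
                   := G :* ((con 1ℚ :+ a :* u :+ b :* u :+ c :* u :+ d :* v) :* P))
           refl (g s) P (cX l) (cY l) (cZ l) (cW l) (recip² q) (recip³ q) ⟩
    g s * (localDensity l q * P) ∎
    where
      open ≡-Reasoning
      P = ∏ L (localDensity l)
      E = expand l L g
      ih = expand-multiplicative l L g gX gY gZ gW

  expand-cong : ∀ l L {f g : Pattern → ℚ} → (∀ s → f s ≡ g s) → ∀ s → expand l L f s ≡ expand l L g s
  expand-cong l [] eq s = eq s
  expand-cong l (q ∷ L) eq s =
    cong₂ _+_ (cong₂ _+_ (cong₂ _+_ (cong₂ _+_ (ih s) (cong (cX l *_) (ih _))) (cong (cY l *_) (ih _)))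
                         (cong (cZ l *_) (ih _))) (cong (cW l *_) (ih _))
    where ih = expand-cong l L eq

  expand-− : ∀ l L (f g : Pattern → ℚ) s → expand l L (λ t → f t - g t) s ≡ expand l L f s - expand l L g s
  expand-− l [] f g s = refl
  expand-− l (q ∷ L) f g s =
    trans (cong₂ _+_ (cong₂ _+_ (cong₂ _+_ (cong₂ _+_ (ih s) (cong (cX l *_) (ih _))) (cong (cY l *_) (ih _)))
                                (cong (cZ l *_) (ih _))) (cong (cW l *_) (ih _)))
      (solve 14 (λ a b c d e a′ b′ c′ d′ e′ k₁ k₂ k₃ k₄ →
          (a :- a′) :+ k₁ :* (b :- b′) :+ k₂ :* (c :- c′) :+ k₃ :* (d :- d′) :+ k₄ :* (e :- e′)
          := (a :+ k₁ :* b :+ k₂ :* c :+ k₃ :* d :+ k₄ :* e) :- (a′ :+ k₁ :* b′ :+ k₂ :* c′ :+ k₃ :* d′ :+ k₄ :* e′))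
        refl (F s) (F (pushX q s)) (F (pushY q s)) (F (pushZ q s)) (F (pushW q s))
             (G s) (G (pushX q s)) (G (pushY q s)) (G (pushZ q s)) (G (pushW q s)) (cX l) (cY l) (cZ l) (cW l))
    where
      ih = expand-− l L f g
      F = expand l L f
      G = expand l L g

  -- The W-coefficient can be 2 (it is for the product of all three coprimality conditions),
  -- so the W-branch is counted twice.
  majorant : List ℕ → (Pattern → ℚ) → Pattern → ℚ
  majorant [] F s = F s
  majorant (q ∷ L) F s = majorant L F s + majorant L F (pushX q s) + majorant L F (pushY q s)
                         + majorant L F (pushZ q s) + (majorant L F (pushW q s) + majorant L F (pushW q s))

  Bounded : Coeffs → Set
  Bounded l = ∣ cX l ∣ ≤ 1ℚ × ∣ cY l ∣ ≤ 1ℚ × ∣ cZ l ∣ ≤ 1ℚ × ∣ cW l ∣ ≤ ι 2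

  ∣expand∣≤majorant : ∀ l → Bounded l → ∀ L (f : Pattern → ℚ) s → ∣ expand l L f s ∣ ≤ majorant L (λ t → ∣ f t ∣) s
  ∣expand∣≤majorant l _ [] f s = ≤-refl
  ∣expand∣≤majorant l bd@(bX , bY , bZ , bW) (q ∷ L) f s = begin
    ∣ E s + cX l * E (pushX q s) + cY l * E (pushY q s) + cZ l * E (pushZ q s) + cW l * E (pushW q s) ∣
      ≤⟨ triangle₅ (E s) (cX l * E (pushX q s)) (cY l * E (pushY q s)) (cZ l * E (pushZ q s)) (cW l * E (pushW q s)) ⟩
    ∣ E s ∣ + ∣ cX l * E (pushX q s) ∣ + ∣ cY l * E (pushY q s) ∣ + ∣ cZ l * E (pushZ q s) ∣ + ∣ cW l * E (pushW q s) ∣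
      ≤⟨ +-mono-≤ (+-mono-≤ (+-mono-≤ (+-mono-≤ (ih s) (∣*∣≤ bX (ih _))) (∣*∣≤ bY (ih _))) (∣*∣≤ bZ (ih _))) (∣*∣≤ bW (ih _)) ⟩
    M s + 1ℚ * M (pushX q s) + 1ℚ * M (pushY q s) + 1ℚ * M (pushZ q s) + ι 2 * M (pushW q s)
      ≡⟨ solve 5 (λ a b c d e → a :+ con 1ℚ :* b :+ con 1ℚ :* c :+ con 1ℚ :* d :+ con (ι 2) :* e := a :+ b :+ c :+ d :+ (e :+ e))
           refl (M s) (M (pushX q s)) (M (pushY q s)) (M (pushZ q s)) (M (pushW q s)) ⟩
    majorant (q ∷ L) (λ t → ∣ f t ∣) s ∎
    where
      open ≤-Reasoning
      E = expand l L f
      M = majorant L (λ t → ∣ f t ∣)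
      ih = ∣expand∣≤majorant l bd L f
      ∣*∣≤ : ∀ {k x c B} → ∣ k ∣ ≤ c → ∣ x ∣ ≤ B → ∣ k * x ∣ ≤ c * B
      ∣*∣≤ {k} {x} k≤c x≤B = ≤-trans (≤-reflexive (∣p*q∣≡∣p∣*∣q∣ k x)) (*-mono-≤-0≤ (0≤∣p∣ k) (0≤∣p∣ x) k≤c x≤B)
      triangle₅ : ∀ a b c d e → ∣ a + b + c + d + e ∣ ≤ ∣ a ∣ + ∣ b ∣ + ∣ c ∣ + ∣ d ∣ + ∣ e ∣
      triangle₅ a b c d e =
        ≤-trans (∣p+q∣≤∣p∣+∣q∣ (a + b + c + d) e) (+-monoˡ-≤ ∣ e ∣
        (≤-trans (∣p+q∣≤∣p∣+∣q∣ (a + b + c) d) (+-monoˡ-≤ ∣ d ∣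
        (≤-trans (∣p+q∣≤∣p∣+∣q∣ (a + b) c) (+-monoˡ-≤ ∣ c ∣ (∣p+q∣≤∣p∣+∣q∣ a b))))))

module LatticeError where

  open import Data.Nat as ℕ using (ℕ; zero; suc)
  import Data.Nat.Properties as ℕP
  open import Data.Nat.DivMod using (_/_; _%_; m≡m%n+[m/n]*n; m%n<n; m/n*n≤m)
  open import Data.Rational.Base hiding (_/_)
  open import Data.Rational.Properties
  open import Data.Rational.Solver
  open import Relation.Nullary using (yes; no)
  open import Data.Empty using (⊥-elim)
  open import Relation.Binary.PropositionalEquality
  open +-*-Solver
  open Rationals
  open EulerExpansion

  m<[1+m/n]n : ∀ m n → m ℕ.< suc (m / suc n) ℕ.* suc n
  m<[1+m/n]n m n = begin-strict
    m                          ≡⟨ trans (m≡m%n+[m/n]*n m d) (ℕP.+-comm (m % d) (m / d ℕ.* d)) ⟩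
    m / d ℕ.* d ℕ.+ m % d      <⟨ ℕP.+-monoʳ-< (m / d ℕ.* d) (m%n<n m d) ⟩
    m / d ℕ.* d ℕ.+ d          ≡⟨ ℕP.+-comm (m / d ℕ.* d) d ⟩
    suc (m / d) ℕ.* d          ∎
    where
      open ℕP.≤-Reasoning
      d = suc n

  module _ (H : ℕ) where

    multiples≤ : ∀ d → ι (multiplesUpTo H d) ≤ ι H * recip d
    multiples≤ zero = ≤-reflexive (sym (*-zeroʳ (ι H)))
    multiples≤ (suc e) = begin
      ι (H / d)                      ≡⟨ sym (*-identityʳ (ι (H / d))) ⟩
      ι (H / d) * 1ℚ                 ≡⟨ cong (ι (H / d) *_) (sym (ι*recip e)) ⟩
      ι (H / d) * (ι d * recip d)    ≡⟨ sym (*-assoc (ι (H / d)) (ι d) (recip d)) ⟩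
      ι (H / d) * ι d * recip d      ≡⟨ cong (_* recip d) (sym (ι-* (H / d) d)) ⟩
      ι (H / d ℕ.* d) * recip d      ≤⟨ *-monoʳ-≤-0≤ (recip d) (recip-nonNeg d) (ι-mono (m/n*n≤m H d)) ⟩
      ι H * recip d                  ∎
      where
        open ≤-Reasoning
        d = suc e

    ≤multiples+1 : ∀ d → ι H * recip d ≤ ι (multiplesUpTo H d) + 1ℚ
    ≤multiples+1 zero = ≤-trans (≤-reflexive (*-zeroʳ (ι H))) (≤-trans 0≤1 (≤-reflexive (sym (+-identityˡ 1ℚ))))
    ≤multiples+1 (suc e) = begin
      ι H * recip d                          ≤⟨ *-monoʳ-≤-0≤ (recip d) (recip-nonNeg d) (ι-mono (ℕP.<⇒≤ (m<[1+m/n]n H e))) ⟩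
      ι (d ℕ.+ H / d ℕ.* d) * recip d        ≡⟨ cong (_* recip d) (trans (ι-+ d (H / d ℕ.* d)) (cong (ι d +_) (ι-* (H / d) d))) ⟩
      (ι d + ι (H / d) * ι d) * recip d      ≡⟨ solve 3 (λ a b c → (b :+ a :* b) :* c := a :* (b :* c) :+ b :* c) refl (ι (H / d)) (ι d) (recip d) ⟩
      ι (H / d) * (ι d * recip d) + ι d * recip d
                                             ≡⟨ cong₂ (λ a b → ι (H / d) * a + b) (ι*recip e) (ι*recip e) ⟩
      ι (H / d) * 1ℚ + 1ℚ                    ≡⟨ cong (_+ 1ℚ) (*-identityʳ (ι (H / d))) ⟩
      ι (H / d) + 1ℚ                         ∎
      where
        open ≤-Reasoning
        d = suc e

    gap : ℕ → ℚ
    gap d = ι H * recip d - ι (multiplesUpTo H d)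

    gap≤1 : ∀ d → gap d ≤ 1ℚ
    gap≤1 d = p≤q+r⇒p-q≤r (≤multiples+1 d)

    gap≤H/d : ∀ d → gap d ≤ ι H * recip d
    gap≤H/d d = ≤-trans (+-monoʳ-≤ (ι H * recip d) (neg-antimono-≤ (ι-nonNeg (multiplesUpTo H d))))
                        (≤-reflexive (+-identityʳ (ι H * recip d)))

    errorWeight : ℕ → ℚ
    errorWeight n with n ℕ.≤? H
    ... | yes _ = recip n
    ... | no _ = ι H * recip n * recip n

    errorWeight-small : ∀ {n} → n ℕ.≤ H → errorWeight n ≡ recip n
    errorWeight-small {n} n≤H with n ℕ.≤? H
    ... | yes _ = refl
    ... | no n≰H = ⊥-elim (n≰H n≤H)

    errorWeight-large : ∀ {n} → H ℕ.< n → errorWeight n ≡ ι H * recip n * recip n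
    errorWeight-large {n} H<n with n ℕ.≤? H
    ... | yes n≤H = ⊥-elim (ℕP.<⇒≱ H<n n≤H)
    ... | no _ = refl

    errorWeight-nonNeg : ∀ n → 0ℚ ≤ errorWeight n
    errorWeight-nonNeg n with n ℕ.≤? H
    ... | yes _ = recip-nonNeg n
    ... | no _ = 0≤p*q (0≤p*q (ι-nonNeg H) (recip-nonNeg n)) (recip-nonNeg n)

    gap*recip≤errorWeight : ∀ n w → gap (n ℕ.* w) * recip n ≤ errorWeight n
    gap*recip≤errorWeight n w with n ℕ.≤? H
    ... | yes _ = ≤-trans (*-monoʳ-≤-0≤ (recip n) (recip-nonNeg n) (gap≤1 (n ℕ.* w))) (≤-reflexive (*-identityˡ (recip n)))
    ... | no _ = *-monoʳ-≤-0≤ (recip n) (recip-nonNeg n)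
                   (≤-trans (gap≤H/d (n ℕ.* w)) (*-monoˡ-≤-0≤ (ι H) (ι-nonNeg H) (recip-*≤ n w)))

  errorBound : ℕ → Pattern → ℚ
  errorBound H (mkPattern x y z w) =
    ι H * ι H * ((errorWeight H (x ℕ.* y) * recip² z + errorWeight H (x ℕ.* z) * recip² y
                  + errorWeight H (y ℕ.* z) * recip² x) * recip² w)

  private
    regroup : ∀ H x y z w (g₁ g₂ g₃ : ℚ) →
      g₁ * (ι H * recip (x ℕ.* z ℕ.* w)) * (ι H * recip (y ℕ.* z ℕ.* w))
        + (ι H * recip (x ℕ.* y ℕ.* w)) * g₂ * (ι H * recip (y ℕ.* z ℕ.* w))
        + (ι H * recip (x ℕ.* y ℕ.* w)) * (ι H * recip (x ℕ.* z ℕ.* w)) * g₃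
      ≡ ι H * ι H * ((g₁ * recip (x ℕ.* y) * recip² z + g₂ * recip (x ℕ.* z) * recip² y
                      + g₃ * recip (y ℕ.* z) * recip² x) * recip² w)
    regroup H x y z w g₁ g₂ g₃
      rewrite recip-*³ x z w | recip-*³ y z w | recip-*³ x y w | recip-* x y | recip-* x z | recip-* y z =
      solve 8 (λ h g₁ g₂ g₃ x y z w →
          g₁ :* (h :* (x :* z :* w)) :* (h :* (y :* z :* w)) :+ (h :* (x :* y :* w)) :* g₂ :* (h :* (y :* z :* w))
            :+ (h :* (x :* y :* w)) :* (h :* (x :* z :* w)) :* g₃
          := h :* h :* ((g₁ :* (x :* y) :* (z :* z) :+ g₂ :* (x :* z) :* (y :* y) :+ g₃ :* (y :* z) :* (x :* x)) :* (w :* w)))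
        refl (ι H) g₁ g₂ g₃ (recip x) (recip y) (recip z) (recip w)

  ∣lattice-volume∣≤errorBound : ∀ H s → ∣ lattice H s - volume H s ∣ ≤ errorBound H s
  ∣lattice-volume∣≤errorBound H s@(mkPattern x y z w) = begin
    ∣ lattice H s - volume H s ∣
      ≤⟨ ∣u₁u₂u₃-v₁v₂v₃∣≤ (ι-nonNeg (multiplesUpTo H (dᵃ s))) (ι-nonNeg (multiplesUpTo H (dᵇ s))) (ι-nonNeg (multiplesUpTo H (dᶜ s)))
           (multiples≤ H (dᵃ s)) (multiples≤ H (dᵇ s)) (multiples≤ H (dᶜ s)) ⟩
    g₁ * v₂ * v₃ + v₁ * g₂ * v₃ + v₁ * v₂ * g₃
      ≡⟨ regroup H x y z w g₁ g₂ g₃ ⟩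
    ι H * ι H * ((g₁ * recip (x ℕ.* y) * recip² z + g₂ * recip (x ℕ.* z) * recip² y + g₃ * recip (y ℕ.* z) * recip² x) * recip² w)
      ≤⟨ *-monoˡ-≤-0≤ (ι H * ι H) (0≤p*q (ι-nonNeg H) (ι-nonNeg H)) (*-monoʳ-≤-0≤ (recip² w) (recip²-nonNeg w)
           (+-mono-≤ (+-mono-≤ (*-monoʳ-≤-0≤ (recip² z) (recip²-nonNeg z) (gap*recip≤errorWeight H (x ℕ.* y) w))
                               (*-monoʳ-≤-0≤ (recip² y) (recip²-nonNeg y) (gap*recip≤errorWeight H (x ℕ.* z) w)))
                     (*-monoʳ-≤-0≤ (recip² x) (recip²-nonNeg x) (gap*recip≤errorWeight H (y ℕ.* z) w)))) ⟩
    errorBound H s ∎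
    where
      open ≤-Reasoning
      v₁ = ι H * recip (dᵃ s)
      v₂ = ι H * recip (dᵇ s)
      v₃ = ι H * recip (dᶜ s)
      g₁ = gap H (dᵃ s)
      g₂ = gap H (dᵇ s)
      g₃ = gap H (dᶜ s)

module DivisorSums where

  open import Data.Nat as ℕ using (ℕ; zero; suc; s≤s; z≤n)
  import Data.Nat.Properties as ℕP
  open import Data.Nat.Divisibility using (_∣_; ∣⇒≤; ∣-refl; ∣-trans; n∣m*n; m∣m*n; *-monoʳ-∣; 0∣⇒≡0)
  open import Data.Nat.ListAction using (product)
  open import Data.Nat.Primality using (Prime; prime⇒nonZero; productOfPrimes≥1)
  open import Data.Nat.Tactic.RingSolver using (solve-∀)
  open import Data.Fin using (Fin; zero; suc)
  open import Data.Rational.Base hiding (_/_)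
  open import Data.Rational.Properties
  open import Data.Rational.Solver
  open import Data.List using (List; []; _∷_; _++_; map)
  open import Data.List.Relation.Unary.All as All using (All; []; _∷_)
  import Data.List.Relation.Unary.All.Properties as AllP
  open import Data.List.Membership.Propositional using (_∈_)
  open import Data.List.Membership.Propositional.Properties using (∈-map⁻)
  open import Data.List.Relation.Unary.Unique.Propositional using (Unique; []; _∷_)
  import Data.List.Relation.Unary.Unique.Propositional.Properties as UniqueP
  open import Data.Product using (_,_; _×_)
  open import Data.Empty using (⊥-elim)
  open import Relation.Nullary using (¬_)
  open import Relation.Binary.PropositionalEquality
  open +-*-Solver
  open Rationals
  open FiniteSums
  open Divisibility
  open EulerExpansion

  subproducts : List ℕ → List ℕ
  subproducts [] = 1 ∷ []
  subproducts (q ∷ L) = subproducts L ++ map (q ℕ.*_) (subproducts L)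

  ∑-subproducts-∷ : ∀ q L h → ∑ (subproducts (q ∷ L)) h ≡ ∑ (subproducts L) h + ∑ (subproducts L) (λ x → h (q ℕ.* x))
  ∑-subproducts-∷ q L h = trans (∑-++ (subproducts L) _ h) (cong (∑ (subproducts L) h +_) (∑-map (subproducts L) (q ℕ.*_) h))

  subproducts-∣ : ∀ L → All (_∣ product L) (subproducts L)
  subproducts-∣ [] = ∣-refl ∷ []
  subproducts-∣ (q ∷ L) = AllP.++⁺ (All.map (λ d∣ → ∣-trans d∣ (n∣m*n q)) (subproducts-∣ L))
                                   (AllP.map⁺ (All.map (*-monoʳ-∣ q) (subproducts-∣ L)))

  subproducts-bounded : ∀ L → All Prime L → All (λ d → 1 ℕ.≤ d × d ℕ.≤ product L) (subproducts L)
  subproducts-bounded L pL = All.map bounded (subproducts-∣ L)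
    where
      1≤∏ = productOfPrimes≥1 pL
      bounded : ∀ {d} → d ∣ product L → 1 ℕ.≤ d × d ℕ.≤ product L
      bounded {zero} 0∣ = ⊥-elim (ℕP.<⇒≢ 1≤∏ (sym (0∣⇒≡0 0∣)))
      bounded {suc d} d∣ = s≤s z≤n , ∣⇒≤ {{ℕ.>-nonZero 1≤∏}} d∣

  subproducts-∤ : ∀ {q} L → Prime q → All Prime L → All (q ≢_) L → All (λ d → ¬ (q ∣ d)) (subproducts L)
  subproducts-∤ [] pq [] [] = prime∤1 pq ∷ []
  subproducts-∤ (p ∷ L) pq (pp ∷ pL) (q≢p ∷ q≢L) =
    AllP.++⁺ q∤L (AllP.map⁺ (All.map (prime∤* pq (λ q∣p → q≢p (prime∣prime⇒≡ pq pp q∣p))) q∤L))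
    where q∤L = subproducts-∤ L pq pL q≢L

  subproducts-unique : ∀ L → All Prime L → Unique L → Unique (subproducts L)
  subproducts-unique [] [] [] = [] ∷ []
  subproducts-unique (q ∷ L) (pq ∷ pL) (q∉L ∷ uL) = UniqueP.++⁺ uD (UniqueP.map⁺ q*-injective uD) disjoint
    where
      uD = subproducts-unique L pL uL
      q*-injective : ∀ {x y} → q ℕ.* x ≡ q ℕ.* y → x ≡ y
      q*-injective {x} {y} = ℕP.*-cancelˡ-≡ x y q {{prime⇒nonZero pq}}
      disjoint : ∀ {v} → ¬ (v ∈ subproducts L × v ∈ map (q ℕ.*_) (subproducts L))
      disjoint (v∈ , v∈qD) with ∈-map⁻ (q ℕ.*_) v∈qD
      ... | (d , _ , refl) = All.lookup (subproducts-∤ L pq pL q∉L) v∈ (m∣m*n d)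

  ∑subproducts≤∑≤ : ∀ L → All Prime L → Unique L → (h : ℕ → ℚ) → (∀ x → 0ℚ ≤ h x) →
                    ∑ (subproducts L) h ≤ ∑≤ (product L) h
  ∑subproducts≤∑≤ L pL uL h 0≤h =
    ∑-unique≤∑≤ h 0≤h (product L) (subproducts L) (subproducts-unique L pL uL) (subproducts-bounded L pL)

  Fun : ℕ → Set
  Fun zero = ℚ
  Fun (suc n) = ℕ → Fun n

  ∑ⁿ : ∀ n → List ℕ → Fun n → ℚ
  ∑ⁿ zero L f = f
  ∑ⁿ (suc n) L f = ∑ (subproducts L) (λ x → ∑ⁿ n L (f x))

  NonNegⁿ : ∀ n → Fun n → Set
  NonNegⁿ zero f = 0ℚ ≤ f
  NonNegⁿ (suc n) f = ∀ x → NonNegⁿ n (f x)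

  _≤ⁿ_ : ∀ {n} → Fun n → Fun n → Set
  _≤ⁿ_ {zero} f g = f ≤ g
  _≤ⁿ_ {suc n} f g = ∀ x → f x ≤ⁿ g x

  _≗ⁿ_ : ∀ {n} → Fun n → Fun n → Set
  _≗ⁿ_ {zero} f g = f ≡ g
  _≗ⁿ_ {suc n} f g = ∀ x → f x ≗ⁿ g x

  scaleⁿ : ∀ n → ℚ → Fun n → Fun n
  scaleⁿ zero k f = k * f
  scaleⁿ (suc n) k f x = scaleⁿ n k (f x)

  addⁿ : ∀ n → Fun n → Fun n → Fun n
  addⁿ zero f g = f + g
  addⁿ (suc n) f g x = addⁿ n (f x) (g x)

  scaleArg : ∀ n → Fin n → ℕ → Fun n → Fun n
  scaleArg (suc n) zero q f x = f (q ℕ.* x)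
  scaleArg (suc n) (suc i) q f x = scaleArg n i q (f x)

  ∑ⁿ-nonNeg : ∀ n L f → NonNegⁿ n f → 0ℚ ≤ ∑ⁿ n L f
  ∑ⁿ-nonNeg zero L f 0≤f = 0≤f
  ∑ⁿ-nonNeg (suc n) L f 0≤f = ∑-nonNeg (subproducts L) (λ x → ∑ⁿ-nonNeg n L (f x) (0≤f x))

  ∑ⁿ-cong : ∀ n L {f g} → f ≗ⁿ g → ∑ⁿ n L f ≡ ∑ⁿ n L g
  ∑ⁿ-cong zero L eq = eq
  ∑ⁿ-cong (suc n) L eq = ∑-cong (subproducts L) (λ x → ∑ⁿ-cong n L (eq x))

  ∑ⁿ-mono : ∀ n L {f g} → f ≤ⁿ g → ∑ⁿ n L f ≤ ∑ⁿ n L g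
  ∑ⁿ-mono zero L le = le
  ∑ⁿ-mono (suc n) L le = ∑-mono (subproducts L) (λ x → ∑ⁿ-mono n L (le x))

  ∑ⁿ-*ˡ : ∀ n L k f → ∑ⁿ n L (scaleⁿ n k f) ≡ k * ∑ⁿ n L f
  ∑ⁿ-*ˡ zero L k f = refl
  ∑ⁿ-*ˡ (suc n) L k f = trans (∑-cong (subproducts L) (λ x → ∑ⁿ-*ˡ n L k (f x))) (∑-*ˡ (subproducts L) k _)

  ∑ⁿ-+ : ∀ n L f g → ∑ⁿ n L (addⁿ n f g) ≡ ∑ⁿ n L f + ∑ⁿ n L g
  ∑ⁿ-+ zero L f g = refl
  ∑ⁿ-+ (suc n) L f g = trans (∑-cong (subproducts L) (λ x → ∑ⁿ-+ n L (f x) (g x))) (∑-+ (subproducts L) _ _)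

  at1 : ∀ n → Fun n → ℚ
  at1 zero f = f
  at1 (suc n) f = at1 n (f 1)

  ∑ⁿ-[] : ∀ n f → ∑ⁿ n [] f ≡ at1 n f
  ∑ⁿ-[] zero f = refl
  ∑ⁿ-[] (suc n) f = trans (+-identityʳ _) (∑ⁿ-[] n (f 1))

  ∑Fin : ∀ n → (Fin n → ℚ) → ℚ
  ∑Fin zero g = 0ℚ
  ∑Fin (suc n) g = g zero + ∑Fin n (λ i → g (suc i))

  ∑Fin-nonNeg : ∀ n g → (∀ i → 0ℚ ≤ g i) → 0ℚ ≤ ∑Fin n g
  ∑Fin-nonNeg zero g _ = ≤-refl
  ∑Fin-nonNeg (suc n) g 0≤g = 0≤p+q (0≤g zero) (∑Fin-nonNeg n _ (λ i → 0≤g (suc i)))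

  ∑-∑Fin : ∀ n (xs : List ℕ) (g : ℕ → Fin n → ℚ) → ∑ xs (λ x → ∑Fin n (g x)) ≡ ∑Fin n (λ i → ∑ xs (λ x → g x i))
  ∑-∑Fin zero [] g = refl
  ∑-∑Fin zero (x ∷ xs) g = trans (+-identityˡ _) (∑-∑Fin zero xs g)
  ∑-∑Fin (suc n) xs g = trans (∑-+ xs (λ x → g x zero) (λ x → ∑Fin n (λ i → g x (suc i))))
    (cong (∑ xs (λ x → g x zero) +_) (∑-∑Fin n xs (λ x i → g x (suc i))))

  -- The left side collects the terms of the right side in which q divides no argument or exactly one.
  ∑ⁿ-∷ : ∀ n q L f → NonNegⁿ n f → ∑ⁿ n L f + ∑Fin n (λ i → ∑ⁿ n L (scaleArg n i q f)) ≤ ∑ⁿ n (q ∷ L) f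
  ∑ⁿ-∷ zero q L f _ = ≤-reflexive (+-identityʳ f)
  ∑ⁿ-∷ (suc n) q L f 0≤f = begin
    ∑ⁿ (suc n) L f + ∑Fin (suc n) (λ i → ∑ⁿ (suc n) L (scaleArg (suc n) i q f))
      ≡⟨ cong (λ t → ∑ⁿ (suc n) L f + (B + t)) (sym (∑-∑Fin n D (λ x i → ∑ⁿ n L (scaleArg n i q (f x))))) ⟩
    A + (B + C)
      ≡⟨ solve 3 (λ A B C → A :+ (B :+ C) := (A :+ C) :+ B) refl A B C ⟩
    A + C + B
      ≡⟨ cong (_+ B) (sym (∑-+ D (λ x → ∑ⁿ n L (f x)) (λ x → ∑Fin n (λ i → ∑ⁿ n L (scaleArg n i q (f x)))))) ⟩
    ∑ D (λ x → ∑ⁿ n L (f x) + ∑Fin n (λ i → ∑ⁿ n L (scaleArg n i q (f x)))) + B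
      ≤⟨ +-mono-≤ (∑-mono D (λ x → ∑ⁿ-∷ n q L (f x) (0≤f x)))
                  (∑-mono D (λ x → ≤-trans (p≤p+q (∑Fin-nonNeg n _ (λ i → ∑ⁿ-nonNeg n L _ (scaleArg-nonNeg n i (f (q ℕ.* x)) (0≤f (q ℕ.* x))))))
                                           (∑ⁿ-∷ n q L (f (q ℕ.* x)) (0≤f (q ℕ.* x))))) ⟩
    ∑ D (λ x → ∑ⁿ n (q ∷ L) (f x)) + ∑ D (λ x → ∑ⁿ n (q ∷ L) (f (q ℕ.* x)))
      ≡⟨ sym (∑-subproducts-∷ q L (λ x → ∑ⁿ n (q ∷ L) (f x))) ⟩
    ∑ⁿ (suc n) (q ∷ L) f ∎
    where
      open ≤-Reasoning
      D = subproducts L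
      A = ∑ⁿ (suc n) L f
      B = ∑ⁿ (suc n) L (scaleArg (suc n) zero q f)
      C = ∑ D (λ x → ∑Fin n (λ i → ∑ⁿ n L (scaleArg n i q (f x))))
      scaleArg-nonNeg : ∀ n i g → NonNegⁿ n g → NonNegⁿ n (scaleArg n i q g)
      scaleArg-nonNeg (suc n) zero g 0≤g x = 0≤g (q ℕ.* x)
      scaleArg-nonNeg (suc n) (suc i) g 0≤g x = scaleArg-nonNeg n i (g x) (0≤g x)

  -- W receives two arguments, matching the double count of the W-branch in `majorant`.
  spread : (Pattern → ℚ) → Pattern → Fun 5
  spread G s x₁ x₂ x₃ x₄ x₅ = G (mkPattern (X s ℕ.* x₁) (Y s ℕ.* x₂) (Z s ℕ.* x₃) (W s ℕ.* (x₄ ℕ.* x₅)))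

  private
    swap₁ : ∀ q a x → q ℕ.* a ℕ.* x ≡ a ℕ.* (q ℕ.* x)
    swap₁ = solve-∀
    swap₂ : ∀ q w a b → q ℕ.* w ℕ.* (a ℕ.* b) ≡ w ℕ.* (q ℕ.* a ℕ.* b)
    swap₂ = solve-∀
    swap₃ : ∀ q w a b → q ℕ.* w ℕ.* (a ℕ.* b) ≡ w ℕ.* (a ℕ.* (q ℕ.* b))
    swap₃ = solve-∀

  majorant≤∑⁵ : ∀ L G → (∀ s → 0ℚ ≤ G s) → ∀ s → majorant L G s ≤ ∑ⁿ 5 L (spread G s)
  majorant≤∑⁵ [] G _ s@(mkPattern x y z w) = ≤-reflexive (trans (cong G ones) (sym (∑ⁿ-[] 5 (spread G s))))
    where
      ones : s ≡ mkPattern (x ℕ.* 1) (y ℕ.* 1) (z ℕ.* 1) (w ℕ.* 1)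
      ones = sym (trans (cong₂ (λ x′ y′ → mkPattern x′ y′ (z ℕ.* 1) (w ℕ.* 1)) (ℕP.*-identityʳ x) (ℕP.*-identityʳ y))
                        (cong₂ (mkPattern x y) (ℕP.*-identityʳ z) (ℕP.*-identityʳ w)))
  majorant≤∑⁵ (q ∷ L) G 0≤G s@(mkPattern x y z w) = begin
    M s + M (pushX q s) + M (pushY q s) + M (pushZ q s) + (M (pushW q s) + M (pushW q s))
      ≤⟨ +-mono-≤ (+-mono-≤ (+-mono-≤ (+-mono-≤ (ih s) (ih (pushX q s))) (ih (pushY q s))) (ih (pushZ q s)))
                  (+-mono-≤ (ih (pushW q s)) (ih (pushW q s))) ⟩
    S (spread G s) + S (spread G (pushX q s)) + S (spread G (pushY q s)) + S (spread G (pushZ q s))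
      + (S (spread G (pushW q s)) + S (spread G (pushW q s)))
      ≡⟨ cong₂ _+_ (cong₂ _+_ (cong₂ _+_ (cong (S (spread G s) +_) onX) onY) onZ) (cong₂ _+_ onW₁ onW₂) ⟩
    S (spread G s) + S (m 0F) + S (m 1F) + S (m 2F) + (S (m 3F) + S (m 4F))
      ≡⟨ solve 6 (λ a b c d e f → a :+ b :+ c :+ d :+ (e :+ f) := a :+ (b :+ (c :+ (d :+ (e :+ (f :+ con 0ℚ))))))
           refl (S (spread G s)) (S (m 0F)) (S (m 1F)) (S (m 2F)) (S (m 3F)) (S (m 4F)) ⟩
    S (spread G s) + ∑Fin 5 (λ i → S (m i))
      ≤⟨ ∑ⁿ-∷ 5 q L (spread G s) (λ _ _ _ _ _ → 0≤G _) ⟩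
    ∑ⁿ 5 (q ∷ L) (spread G s) ∎
    where
      open ≤-Reasoning
      open import Data.Fin.Patterns using (0F; 1F; 2F; 3F; 4F)
      M = majorant L G
      S = ∑ⁿ 5 L
      ih = majorant≤∑⁵ L G 0≤G
      m : Fin 5 → Fun 5
      m i = scaleArg 5 i q (spread G s)
      onX : S (spread G (pushX q s)) ≡ S (m 0F)
      onX = ∑ⁿ-cong 5 L (λ a b c d e → cong (λ t → G (mkPattern t (y ℕ.* b) (z ℕ.* c) (w ℕ.* (d ℕ.* e)))) (swap₁ q x a))
      onY : S (spread G (pushY q s)) ≡ S (m 1F)
      onY = ∑ⁿ-cong 5 L (λ a b c d e → cong (λ t → G (mkPattern (x ℕ.* a) t (z ℕ.* c) (w ℕ.* (d ℕ.* e)))) (swap₁ q y b))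
      onZ : S (spread G (pushZ q s)) ≡ S (m 2F)
      onZ = ∑ⁿ-cong 5 L (λ a b c d e → cong (λ t → G (mkPattern (x ℕ.* a) (y ℕ.* b) t (w ℕ.* (d ℕ.* e)))) (swap₁ q z c))
      onW₁ : S (spread G (pushW q s)) ≡ S (m 3F)
      onW₁ = ∑ⁿ-cong 5 L (λ a b c d e → cong (λ t → G (mkPattern (x ℕ.* a) (y ℕ.* b) (z ℕ.* c) t)) (swap₂ q w d e))
      onW₂ : S (spread G (pushW q s)) ≡ S (m 4F)
      onW₂ = ∑ⁿ-cong 5 L (λ a b c d e → cong (λ t → G (mkPattern (x ℕ.* a) (y ℕ.* b) (z ℕ.* c) t)) (swap₃ q w d e))

module HarmonicBounds where

  open import Data.Nat as ℕ using (ℕ; zero; suc; s≤s; z≤n; ⌊_/2⌋)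
  import Data.Nat.Properties as ℕP
  open import Data.Nat.DivMod using (_/_; m/n*n≤m; m/n≤m; m≥n⇒m/n>0)
  open import Data.Nat.Logarithm using (⌊log₂_⌋; ⌊log₂⌋-mono-≤; ⌊log₂⌊n/2⌋⌋≡⌊log₂n⌋∸1)
  open import Data.Nat.Induction using (<-rec)
  open import Data.Nat.Tactic.RingSolver using (solve-∀)
  open import Data.Rational.Base hiding (_/_)
  open import Data.Rational.Properties
  open import Data.Rational.Solver
  open import Data.Product using (_,_)
  open import Data.Sum using (inj₁; inj₂)
  open import Relation.Binary.PropositionalEquality
  open +-*-Solver
  open Rationals
  open FiniteSums
  open LatticeError

  recip-telescope : ∀ n → recip (suc n) * recip (suc (suc n)) ≡ recip (suc n) - recip (suc (suc n))
  recip-telescope n = begin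
    a * b                                               ≡⟨ sym (*-identityʳ (a * b)) ⟩
    a * b * 1ℚ                                          ≡⟨ cong (a * b *_) (solve 1 (λ x → con 1ℚ := (con 1ℚ :+ x) :- x) refl (ι (suc n))) ⟩
    a * b * (ι (suc (suc n)) - ι (suc n))               ≡⟨ solve 4 (λ a b x y → a :* b :* (x :- y) := a :* (b :* x) :- b :* (a :* y)) refl a b (ι (suc (suc n))) (ι (suc n)) ⟩
    a * (b * ι (suc (suc n))) - b * (a * ι (suc n))     ≡⟨ cong₂ (λ s t → a * s - b * t) (recip*ι (suc n)) (recip*ι n) ⟩
    a * 1ℚ - b * 1ℚ                                     ≡⟨ cong₂ _-_ (*-identityʳ a) (*-identityʳ b) ⟩
    a - b                                               ∎
    where
      open ≡-Reasoning
      a = recip (suc n)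
      b = recip (suc (suc n))

  recip²≤telescope : ∀ n → 1 ℕ.≤ n → recip² (suc n) ≤ recip n - recip (suc n)
  recip²≤telescope (suc n) _ =
    ≤-trans (*-monoʳ-≤-0≤ (recip (suc (suc n))) (recip-nonNeg (suc (suc n))) (recip-antitone (s≤s z≤n) (ℕP.n≤1+n (suc n))))
            (≤-reflexive (recip-telescope n))

  module _ (ψ : ℕ → ℚ) {M : ℕ} {B c : ℚ} (1≤M : 1 ℕ.≤ M) (0≤B : 0ℚ ≤ B) (0≤c : 0ℚ ≤ c)
           (small : ∀ y → 1 ℕ.≤ y → y ℕ.≤ M → ψ y ≤ B * recip y) (large : ∀ y → M ℕ.< y → ψ y ≤ c * recip² y) where

    private
      head : ∀ N → N ℕ.≤ M → ∑≤ N ψ ≤ B * ∑≤ N recip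
      head zero _ = ≤-reflexive (sym (*-zeroʳ B))
      head (suc N) N<M = ≤-trans (+-mono-≤ (small (suc N) (s≤s z≤n) N<M) (head N (ℕP.≤-trans (ℕP.n≤1+n N) N<M)))
                                 (≤-reflexive (sym (*-distribˡ-+ B (recip (suc N)) (∑≤ N recip))))

      tail : ∀ k → ∑≤ (k ℕ.+ M) ψ ≤ B * ∑≤ M recip + c * (recip M - recip (k ℕ.+ M))
      tail zero = ≤-trans (head M ℕP.≤-refl)
        (≤-reflexive (solve 4 (λ B S c r → B :* S := B :* S :+ c :* (r :- r)) refl B (∑≤ M recip) c (recip M)))
      tail (suc k) = begin
        ψ (suc (k ℕ.+ M)) + ∑≤ (k ℕ.+ M) ψ
          ≤⟨ +-mono-≤ (≤-trans (large (suc (k ℕ.+ M)) (s≤s (ℕP.m≤n+m M k)))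
                               (*-monoˡ-≤-0≤ c 0≤c (recip²≤telescope (k ℕ.+ M) (ℕP.≤-trans 1≤M (ℕP.m≤n+m M k)))))
                      (tail k) ⟩
        c * (x - y) + (B * S + c * (z - x))
          ≡⟨ solve 6 (λ c x y B S z → c :* (x :- y) :+ (B :* S :+ c :* (z :- x)) := B :* S :+ c :* (z :- y)) refl c x y B S z ⟩
        B * S + c * (z - y) ∎
        where
          open ≤-Reasoning
          x = recip (k ℕ.+ M)
          y = recip (suc (k ℕ.+ M))
          S = ∑≤ M recip
          z = recip M

    ∑≤-two-regimes : ∀ N → ∑≤ N ψ ≤ B * ∑≤ M recip + c * recip M
    ∑≤-two-regimes N with ℕP.≤-total N M
    ... | inj₁ N≤M = ≤-trans (head N N≤M)
                      (≤-trans (*-monoˡ-≤-0≤ B 0≤B (∑≤-monoᴺ recip recip-nonNeg N≤M))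
                               (p≤p+q (0≤p*q 0≤c (recip-nonNeg M))))
    ... | inj₂ M≤N with ℕP.m≤n⇒∃[o]m+o≡n M≤N
    ...   | k , refl = ≤-trans (≤-reflexive (cong (λ t → ∑≤ t ψ) (ℕP.+-comm M k)))
                         (≤-trans (tail k) (+-monoʳ-≤ (B * ∑≤ M recip)
                           (*-monoˡ-≤-0≤ c 0≤c (≤-trans (+-monoʳ-≤ (recip M) (neg-antimono-≤ (recip-nonNeg (k ℕ.+ M))))
                                                        (≤-reflexive (+-identityʳ (recip M)))))))

  ∑≤recip²≤2 : ∀ N → ∑≤ N recip² ≤ ι 2
  ∑≤recip²≤2 N = ∑≤-two-regimes recip² (s≤s z≤n) 0≤1 0≤1 small large N
    where
      small : ∀ y → 1 ℕ.≤ y → y ℕ.≤ 1 → recip² y ≤ 1ℚ * recip y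
      small (suc zero) _ _ = ≤-refl
      small (suc (suc y)) _ (s≤s ())
      large : ∀ y → 1 ℕ.< y → recip² y ≤ 1ℚ * recip² y
      large y _ = ≤-reflexive (sym (*-identityˡ (recip² y)))

  private
    H/[a⌊H/a⌋]≤2 : ∀ H a′ → suc a′ ℕ.≤ H → ι H * recip (suc a′) * recip (H / suc a′) ≤ ι 2
    H/[a⌊H/a⌋]≤2 H a′ a≤H = begin
      ι H * recip a * recip M
        ≤⟨ *-monoʳ-≤-0≤ (recip M) (recip-nonNeg M) (*-monoʳ-≤-0≤ (recip a) (recip-nonNeg a)
             (ι-mono (ℕP.<⇒≤ (ℕP.<-≤-trans (m<[1+m/n]n H a′) (ℕP.*-monoˡ-≤ a (ℕP.+-monoˡ-≤ M 1≤M)))))) ⟩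
      ι ((M ℕ.+ M) ℕ.* a) * recip a * recip M
        ≡⟨ cong (λ t → t * recip a * recip M) (trans (ι-* (M ℕ.+ M) a) (cong (_* ι a) (ι-+ M M))) ⟩
      (ι M + ι M) * ι a * recip a * recip M
        ≡⟨ solve 4 (λ m x ra rm → (m :+ m) :* x :* ra :* rm := (m :* rm :+ m :* rm) :* (x :* ra)) refl (ι M) (ι a) (recip a) (recip M) ⟩
      (ι M * recip M + ι M * recip M) * (ι a * recip a)
        ≡⟨ cong₂ (λ s t → (s + s) * t) (ι*recip′ 1≤M) (ι*recip a′) ⟩
      ι 2 ∎
      where
        open ≤-Reasoning
        a = suc a′
        M = H / a
        1≤M : 1 ℕ.≤ M
        1≤M = m≥n⇒m/n>0 a≤H
        ι*recip′ : ∀ {m} → 1 ℕ.≤ m → ι m * recip m ≡ 1ℚ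
        ι*recip′ {suc m} _ = ι*recip m

  ∑≤-errorWeight-multiples : ∀ H a → 1 ℕ.≤ a → a ℕ.≤ H → ∀ N →
                             ∑≤ N (λ y → errorWeight H (a ℕ.* y)) ≤ recip a * (∑≤ H recip + ι 2)
  ∑≤-errorWeight-multiples H a@(suc a′) _ a≤H N = begin
    ∑≤ N ψ
      ≤⟨ ∑≤-two-regimes ψ (m≥n⇒m/n>0 a≤H) (recip-nonNeg a) 0≤c small large N ⟩
    recip a * ∑≤ M recip + c * recip M
      ≡⟨ cong (recip a * ∑≤ M recip +_) (solve 4 (λ h x z m → h :* x :* z :* m := z :* (h :* x :* m)) refl (ι H) (recip a) (recip a) (recip M)) ⟩
    recip a * ∑≤ M recip + recip a * (ι H * recip a * recip M)
      ≤⟨ +-mono-≤ (*-monoˡ-≤-0≤ (recip a) (recip-nonNeg a) (∑≤-monoᴺ recip recip-nonNeg (m/n≤m H a)))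
                  (*-monoˡ-≤-0≤ (recip a) (recip-nonNeg a) (H/[a⌊H/a⌋]≤2 H a′ a≤H)) ⟩
    recip a * ∑≤ H recip + recip a * ι 2
      ≡⟨ sym (*-distribˡ-+ (recip a) _ _) ⟩
    recip a * (∑≤ H recip + ι 2) ∎
    where
      open ≤-Reasoning
      ψ = λ y → errorWeight H (a ℕ.* y)
      M = H / a
      c = ι H * recip a * recip a
      0≤c : 0ℚ ≤ c
      0≤c = 0≤p*q (0≤p*q (ι-nonNeg H) (recip-nonNeg a)) (recip-nonNeg a)
      small : ∀ y → 1 ℕ.≤ y → y ℕ.≤ M → ψ y ≤ recip a * recip y
      small y _ y≤M = ≤-reflexive (trans (errorWeight-small H ay≤H) (recip-* a y))
        where
          ay≤H : a ℕ.* y ℕ.≤ H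
          ay≤H = ℕP.≤-trans (ℕP.*-monoʳ-≤ a y≤M) (ℕP.≤-trans (ℕP.≤-reflexive (ℕP.*-comm a M)) (m/n*n≤m H a))
      large : ∀ y → M ℕ.< y → ψ y ≤ c * recip² y
      large y M<y = ≤-reflexive (trans (errorWeight-large H H<ay)
                      (trans (cong (λ t → ι H * t * t) (recip-* a y))
                        (solve 3 (λ h x z → h :* (x :* z) :* (x :* z) := h :* x :* x :* (z :* z)) refl (ι H) (recip a) (recip y))))
        where
          H<ay : H ℕ.< a ℕ.* y
          H<ay = ℕP.<-≤-trans (m<[1+m/n]n H a′) (ℕP.≤-trans (ℕP.≤-reflexive (ℕP.*-comm (suc M) a)) (ℕP.*-monoʳ-≤ a M<y))

  ∑≤∑≤-errorWeight : ∀ H → 1 ℕ.≤ H → ∀ N →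
                     ∑≤ N (λ a → ∑≤ N (λ y → errorWeight H (a ℕ.* y))) ≤ (∑≤ H recip + ι 2) * ∑≤ H recip + ι 2
  ∑≤∑≤-errorWeight H@(suc H′) 1≤H N = ≤-trans (∑≤-two-regimes φ 1≤H 0≤B 0≤c small large N) (≤-reflexive (cong (B * ∑≤ H recip +_) c/H≡2))
    where
      φ = λ a → ∑≤ N (λ y → errorWeight H (a ℕ.* y))
      B = ∑≤ H recip + ι 2
      c = ι 2 * ι H
      0≤B : 0ℚ ≤ B
      0≤B = 0≤p+q (∑≤-nonNeg H recip-nonNeg) (ι-nonNeg 2)
      0≤c : 0ℚ ≤ c
      0≤c = 0≤p*q (ι-nonNeg 2) (ι-nonNeg H)
      small : ∀ a → 1 ℕ.≤ a → a ℕ.≤ H → φ a ≤ B * recip a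
      small a 1≤a a≤H = ≤-trans (∑≤-errorWeight-multiples H a 1≤a a≤H N) (≤-reflexive (*-comm (recip a) B))
      large : ∀ a → H ℕ.< a → φ a ≤ c * recip² a
      large a H<a = begin
        ∑≤ N (λ y → errorWeight H (a ℕ.* y))     ≤⟨ ∑≤-mono N (λ y 1≤y → ≤-reflexive (split y 1≤y)) ⟩
        ∑≤ N (λ y → (ι H * recip² a) * recip² y) ≡⟨ ∑-*ˡ (downFrom₁ N) (ι H * recip² a) recip² ⟩
        (ι H * recip² a) * ∑≤ N recip²           ≤⟨ *-monoˡ-≤-0≤ (ι H * recip² a) (0≤p*q (ι-nonNeg H) (recip²-nonNeg a)) (∑≤recip²≤2 N) ⟩
        (ι H * recip² a) * ι 2                   ≡⟨ solve 3 (λ h x t → h :* x :* t := t :* h :* x) refl (ι H) (recip² a) (ι 2) ⟩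
        c * recip² a                             ∎
        where
          open ≤-Reasoning
          split : ∀ y → 1 ℕ.≤ y → errorWeight H (a ℕ.* y) ≡ (ι H * recip² a) * recip² y
          split y 1≤y = trans (errorWeight-large H (ℕP.<-≤-trans H<a (ℕP.m≤m*n a y {{ℕ.>-nonZero 1≤y}})))
                          (trans (cong (λ t → ι H * t * t) (recip-* a y))
                            (solve 3 (λ h x z → h :* (x :* z) :* (x :* z) := h :* (x :* x) :* (z :* z)) refl (ι H) (recip a) (recip y)))
      c/H≡2 : c * recip H ≡ ι 2
      c/H≡2 = trans (*-assoc (ι 2) (ι H) (recip H)) (trans (cong (ι 2 *_) (ι*recip H′)) (*-identityʳ (ι 2)))

  private
    odd : ℕ → ℕ
    odd m = suc (m ℕ.+ m)

    ∑≤recip-odd : ∀ m → ∑≤ (odd m) recip ≤ 1ℚ + ∑≤ m recip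
    ∑≤recip-odd zero = ≤-refl
    ∑≤recip-odd (suc m) = begin
      ∑≤ (odd (suc m)) recip
        ≡⟨ cong (λ t → ∑≤ (suc t) recip) (ℕP.+-suc (suc m) m) ⟩
      recip (suc (suc (suc (m ℕ.+ m)))) + (recip (suc (suc (m ℕ.+ m))) + ∑≤ (odd m) recip)
        ≤⟨ +-mono-≤ (recip-antitone {suc (suc (m ℕ.+ m))} (s≤s z≤n) (ℕP.n≤1+n _)) (+-monoʳ-≤ x (∑≤recip-odd m)) ⟩
      x + (x + (1ℚ + ∑≤ m recip))
        ≡⟨ solve 2 (λ x S → x :+ (x :+ (con 1ℚ :+ S)) := con 1ℚ :+ ((x :+ x) :+ S)) refl x (∑≤ m recip) ⟩
      1ℚ + ((x + x) + ∑≤ m recip)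
        ≡⟨ cong (λ t → 1ℚ + (t + ∑≤ m recip)) x+x≡ ⟩
      1ℚ + ∑≤ (suc m) recip ∎
      where
        open ≤-Reasoning
        x = recip (suc (suc (m ℕ.+ m)))
        2[1+m] : ∀ m → suc (suc (m ℕ.+ m)) ≡ 2 ℕ.* suc m
        2[1+m] = solve-∀
        x+x≡ : x + x ≡ recip (suc m)
        x+x≡ = begin-equality
          x + x                                        ≡⟨ cong (λ t → recip t + recip t) (2[1+m] m) ⟩
          recip (2 ℕ.* suc m) + recip (2 ℕ.* suc m)    ≡⟨ cong (λ t → t + t) (recip-* 2 (suc m)) ⟩
          recip 2 * recip (suc m) + recip 2 * recip (suc m)
                                                       ≡⟨ sym (*-distribʳ-+ (recip (suc m)) (recip 2) (recip 2)) ⟩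
          (recip 2 + recip 2) * recip (suc m)          ≡⟨ *-identityˡ (recip (suc m)) ⟩
          recip (suc m)                                ∎

    n≤odd⌊n/2⌋ : ∀ n → n ℕ.≤ odd ⌊ n /2⌋
    n≤odd⌊n/2⌋ zero = z≤n
    n≤odd⌊n/2⌋ (suc zero) = s≤s z≤n
    n≤odd⌊n/2⌋ (suc (suc n)) = s≤s (ℕP.≤-trans (s≤s (n≤odd⌊n/2⌋ n)) (ℕP.≤-reflexive (cong suc (sym (ℕP.+-suc ⌊ n /2⌋ ⌊ n /2⌋)))))

  harmonic≤1+log₂ : ∀ n → 1 ℕ.≤ n → ∑≤ n recip ≤ 1ℚ + ι ⌊log₂ n ⌋
  harmonic≤1+log₂ = <-rec (λ n → 1 ℕ.≤ n → ∑≤ n recip ≤ 1ℚ + ι ⌊log₂ n ⌋) step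
    where
      step : ∀ n → (∀ {m} → m ℕ.< n → 1 ℕ.≤ m → ∑≤ m recip ≤ 1ℚ + ι ⌊log₂ m ⌋) → 1 ℕ.≤ n → ∑≤ n recip ≤ 1ℚ + ι ⌊log₂ n ⌋
      step (suc zero) _ _ = ≤-refl
      step n@(suc (suc k)) ih _ = begin
        ∑≤ n recip                          ≤⟨ ∑≤-monoᴺ recip recip-nonNeg (n≤odd⌊n/2⌋ n) ⟩
        ∑≤ (odd ⌊ n /2⌋) recip              ≤⟨ ∑≤recip-odd ⌊ n /2⌋ ⟩
        1ℚ + ∑≤ ⌊ n /2⌋ recip               ≤⟨ +-monoʳ-≤ 1ℚ (ih (ℕP.⌊n/2⌋<n (suc k)) (s≤s z≤n)) ⟩
        1ℚ + (1ℚ + ι ⌊log₂ ⌊ n /2⌋ ⌋)       ≡⟨ cong (λ t → 1ℚ + (1ℚ + ι t)) (⌊log₂⌊n/2⌋⌋≡⌊log₂n⌋∸1 n) ⟩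
        1ℚ + (1ℚ + ι (⌊log₂ n ⌋ ℕ.∸ 1))     ≡⟨ cong (1ℚ +_) (cong ι (ℕP.m+[n∸m]≡n 1≤log₂n)) ⟩
        1ℚ + ι ⌊log₂ n ⌋                    ∎
        where
          open ≤-Reasoning
          1≤log₂n : 1 ℕ.≤ ⌊log₂ n ⌋
          1≤log₂n = ⌊log₂⌋-mono-≤ {2} {n} (s≤s (s≤s z≤n))

module LocalFactorEstimate where

  open import Data.Nat as ℕ using (ℕ; s≤s; z≤n)
  import Data.Nat.Properties as ℕP
  open import Data.Nat.Divisibility using (1∣_)
  open import Data.Nat.Logarithm using (⌊log₂_⌋; ⌊log₂⌋-mono-≤)
  open import Data.Nat.ListAction using (product)
  open import Data.Nat.Primality using (Prime)
  open import Data.Rational.Base hiding (_/_)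
  open import Data.Rational.Properties
  open import Data.Rational.Solver
  open import Data.List using (List)
  open import Data.List.Relation.Unary.All as All using (All)
  open import Data.List.Relation.Unary.Unique.Propositional using (Unique)
  open import Data.Product using (_,_)
  open import Relation.Binary.PropositionalEquality
  open +-*-Solver
  open Rationals
  open FiniteSums
  open Divisibility
  open EulerExpansion
  open LatticeError
  open DivisorSums
  open HarmonicBounds

  module _ (H : ℕ) (L : List ℕ) where

    Q : ℚ
    Q = ∑ (subproducts L) recip²

    Ψ : ℚ
    Ψ = ∑ (subproducts L) (λ a → ∑ (subproducts L) (λ c → errorWeight H (a ℕ.* c)))

    term₁ term₂ term₃ : Fun 5
    term₁ a b c d e = errorWeight H (a ℕ.* b) * (recip² c * (recip² d * recip² e))
    term₂ a b c d e = recip² b * (errorWeight H (a ℕ.* c) * (recip² d * recip² e))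
    term₃ a b c d e = recip² a * (errorWeight H (b ℕ.* c) * (recip² d * recip² e))

    private
      D = subproducts L

      ∑-Q² : ∑ⁿ 2 L (λ d e → recip² d * recip² e) ≡ Q * Q
      ∑-Q² = trans (∑-cong D (λ d → ∑-*ˡ D (recip² d) recip²)) (∑-*ʳ D Q recip²)

      ∑-Ψₐ : ∀ a → ∑ⁿ 3 L (λ c d e → errorWeight H (a ℕ.* c) * (recip² d * recip² e))
                   ≡ ∑ D (λ c → errorWeight H (a ℕ.* c)) * (Q * Q)
      ∑-Ψₐ a = trans (∑-cong D (λ c → trans (∑ⁿ-*ˡ 2 L (errorWeight H (a ℕ.* c)) _) (cong (errorWeight H (a ℕ.* c) *_) ∑-Q²)))
                     (∑-*ʳ D (Q * Q) _)

    ∑-term₁ : ∑ⁿ 5 L term₁ ≡ Ψ * (Q * (Q * Q))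
    ∑-term₁ = begin
      ∑ D (λ a → ∑ D (λ b → ∑ⁿ 3 L (scaleⁿ 3 (errorWeight H (a ℕ.* b)) (λ c d e → recip² c * (recip² d * recip² e)))))
        ≡⟨ ∑-cong D (λ a → ∑-cong D (λ b → trans (∑ⁿ-*ˡ 3 L (errorWeight H (a ℕ.* b)) _) (cong (errorWeight H (a ℕ.* b) *_) Q³))) ⟩
      ∑ D (λ a → ∑ D (λ b → errorWeight H (a ℕ.* b) * (Q * (Q * Q))))
        ≡⟨ trans (∑-cong D (λ a → ∑-*ʳ D _ _)) (∑-*ʳ D _ _) ⟩
      Ψ * (Q * (Q * Q)) ∎
      where
        open ≡-Reasoning
        Q³ : ∑ⁿ 3 L (λ c d e → recip² c * (recip² d * recip² e)) ≡ Q * (Q * Q)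
        Q³ = trans (∑-cong D (λ c → trans (∑ⁿ-*ˡ 2 L (recip² c) _) (cong (recip² c *_) ∑-Q²))) (∑-*ʳ D (Q * Q) recip²)

    ∑-term₂ : ∑ⁿ 5 L term₂ ≡ Q * (Ψ * (Q * Q))
    ∑-term₂ = begin
      ∑ D (λ a → ∑ D (λ b → ∑ⁿ 3 L (scaleⁿ 3 (recip² b) (λ c d e → errorWeight H (a ℕ.* c) * (recip² d * recip² e)))))
        ≡⟨ ∑-cong D (λ a → ∑-cong D (λ b → trans (∑ⁿ-*ˡ 3 L (recip² b) _) (cong (recip² b *_) (∑-Ψₐ a)))) ⟩
      ∑ D (λ a → ∑ D (λ b → recip² b * (Ψₐ a * (Q * Q))))
        ≡⟨ ∑-cong D (λ a → ∑-*ʳ D _ recip²) ⟩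
      ∑ D (λ a → Q * (Ψₐ a * (Q * Q)))
        ≡⟨ ∑-*ˡ D Q _ ⟩
      Q * ∑ D (λ a → Ψₐ a * (Q * Q))
        ≡⟨ cong (Q *_) (∑-*ʳ D (Q * Q) Ψₐ) ⟩
      Q * (Ψ * (Q * Q)) ∎
      where
        open ≡-Reasoning
        Ψₐ = λ a → ∑ D (λ c → errorWeight H (a ℕ.* c))

    ∑-term₃ : ∑ⁿ 5 L term₃ ≡ Q * (Ψ * (Q * Q))
    ∑-term₃ = begin
      ∑ D (λ a → ∑ⁿ 4 L (scaleⁿ 4 (recip² a) (λ b c d e → errorWeight H (b ℕ.* c) * (recip² d * recip² e))))
        ≡⟨ ∑-cong D (λ a → ∑ⁿ-*ˡ 4 L (recip² a) _) ⟩
      ∑ D (λ a → recip² a * ∑ⁿ 4 L (λ b c d e → errorWeight H (b ℕ.* c) * (recip² d * recip² e)))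
        ≡⟨ ∑-*ʳ D _ recip² ⟩
      Q * ∑ D (λ b → ∑ⁿ 3 L (λ c d e → errorWeight H (b ℕ.* c) * (recip² d * recip² e)))
        ≡⟨ cong (Q *_) (trans (∑-cong D ∑-Ψₐ) (∑-*ʳ D (Q * Q) _)) ⟩
      Q * (Ψ * (Q * Q)) ∎
      where open ≡-Reasoning

    ∑⁵-errorBound : ∑ⁿ 5 L (spread (errorBound H) unitPattern)
                    ≡ ι H * ι H * (Ψ * (Q * (Q * Q)) + Q * (Ψ * (Q * Q)) + Q * (Ψ * (Q * Q)))
    ∑⁵-errorBound = begin
      ∑ⁿ 5 L (spread (errorBound H) unitPattern)
        ≡⟨ ∑ⁿ-cong 5 L pointwise ⟩
      ∑ⁿ 5 L (scaleⁿ 5 (ι H * ι H) (addⁿ 5 (addⁿ 5 term₁ term₂) term₃))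
        ≡⟨ ∑ⁿ-*ˡ 5 L (ι H * ι H) _ ⟩
      ι H * ι H * ∑ⁿ 5 L (addⁿ 5 (addⁿ 5 term₁ term₂) term₃)
        ≡⟨ cong (ι H * ι H *_) (trans (∑ⁿ-+ 5 L _ term₃) (cong (_+ ∑ⁿ 5 L term₃) (∑ⁿ-+ 5 L term₁ term₂))) ⟩
      ι H * ι H * (∑ⁿ 5 L term₁ + ∑ⁿ 5 L term₂ + ∑ⁿ 5 L term₃)
        ≡⟨ cong (ι H * ι H *_) (cong₂ _+_ (cong₂ _+_ ∑-term₁ ∑-term₂) ∑-term₃) ⟩
      ι H * ι H * (Ψ * (Q * (Q * Q)) + Q * (Ψ * (Q * Q)) + Q * (Ψ * (Q * Q))) ∎
      where
        open ≡-Reasoning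
        pointwise : spread (errorBound H) unitPattern ≗ⁿ scaleⁿ 5 (ι H * ι H) (addⁿ 5 (addⁿ 5 term₁ term₂) term₃)
        pointwise a b c d e = begin
          errorBound H (mkPattern (1 ℕ.* a) (1 ℕ.* b) (1 ℕ.* c) (1 ℕ.* (d ℕ.* e)))
            ≡⟨ cong (errorBound H) (trans (cong₂ (λ a′ b′ → mkPattern a′ b′ (1 ℕ.* c) (1 ℕ.* (d ℕ.* e))) (ℕP.*-identityˡ a) (ℕP.*-identityˡ b))
                                          (cong₂ (mkPattern a b) (ℕP.*-identityˡ c) (ℕP.*-identityˡ (d ℕ.* e)))) ⟩
          errorBound H (mkPattern a b c (d ℕ.* e))
            ≡⟨ cong (λ t → ι H * ι H * ((wab * recip² c + wac * recip² b + wbc * recip² a) * t)) recip²-* ⟩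
          ι H * ι H * ((wab * recip² c + wac * recip² b + wbc * recip² a) * (recip² d * recip² e))
            ≡⟨ cong (ι H * ι H *_) (solve 7 (λ x y z ra rb rc R → (x :* rc :+ y :* rb :+ z :* ra) :* R
                                                  := x :* (rc :* R) :+ rb :* (y :* R) :+ ra :* (z :* R))
                                    refl wab wac wbc (recip² a) (recip² b) (recip² c) (recip² d * recip² e)) ⟩
          ι H * ι H * (term₁ a b c d e + term₂ a b c d e + term₃ a b c d e) ∎
          where
            wab = errorWeight H (a ℕ.* b)
            wac = errorWeight H (a ℕ.* c)
            wbc = errorWeight H (b ℕ.* c)
            recip²-* : recip² (d ℕ.* e) ≡ recip² d * recip² e
            recip²-* = trans (cong₂ _*_ (recip-* d e) (recip-* d e))
                             (solve 2 (λ x y → (x :* y) :* (x :* y) := (x :* x) :* (y :* y)) refl (recip d) (recip e))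

  module _ (H : ℕ) (2≤H : 2 ℕ.≤ H) (L : List ℕ) (pL : All Prime L) (uL : Unique L) where

    private
      D = subproducts L
      ℓ = ⌊log₂ H ⌋
      S = ∑≤ H recip
      0≤Q : 0ℚ ≤ Q H L
      0≤Q = ∑-nonNeg D recip²-nonNeg
      0≤Ψ : 0ℚ ≤ Ψ H L
      0≤Ψ = ∑-nonNeg D (λ a → ∑-nonNeg D (λ c → errorWeight-nonNeg H (a ℕ.* c)))

    Q≤2 : Q H L ≤ ι 2
    Q≤2 = ≤-trans (∑subproducts≤∑≤ L pL uL recip² recip²-nonNeg)
                  (∑≤recip²≤2 (product L))

    Ψ≤ : Ψ H L ≤ (S + ι 2) * S + ι 2
    Ψ≤ = ≤-trans (∑subproducts≤∑≤ L pL uL _ (λ a → ∑-nonNeg D (λ c → errorWeight-nonNeg H (a ℕ.* c))))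
           (≤-trans (∑≤-mono (product L) (λ a _ → ∑subproducts≤∑≤ L pL uL _ (λ c → errorWeight-nonNeg H (a ℕ.* c))))
                    (∑≤∑≤-errorWeight H (ℕP.≤-trans (s≤s z≤n) 2≤H) (product L)))

    [S+2]S+2≤10ℓ² : (S + ι 2) * S + ι 2 ≤ ι 10 * (ι ℓ * ι ℓ)
    [S+2]S+2≤10ℓ² = begin
      (S + ι 2) * S + ι 2
        ≤⟨ +-monoˡ-≤ (ι 2) (*-mono-≤-0≤ (0≤p+q 0≤S (ι-nonNeg 2)) 0≤S (+-monoˡ-≤ (ι 2) S≤1+ℓ) S≤1+ℓ) ⟩
      (1ℚ + ι ℓ + ι 2) * (1ℚ + ι ℓ) + ι 2
        ≤⟨ p≤p+q (0≤p+q (0≤p*q (0≤p*q (ι-nonNeg 9) 0≤ℓ-1) 0≤ℓ-1) (0≤p*q (ι-nonNeg 14) 0≤ℓ-1)) ⟩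
      (1ℚ + ι ℓ + ι 2) * (1ℚ + ι ℓ) + ι 2 + (ι 9 * (ι ℓ - 1ℚ) * (ι ℓ - 1ℚ) + ι 14 * (ι ℓ - 1ℚ))
        ≡⟨ solve 1 (λ l → (con 1ℚ :+ l :+ con (ι 2)) :* (con 1ℚ :+ l) :+ con (ι 2)
                            :+ (con (ι 9) :* (l :- con 1ℚ) :* (l :- con 1ℚ) :+ con (ι 14) :* (l :- con 1ℚ))
                          := con (ι 10) :* (l :* l)) refl (ι ℓ) ⟩
      ι 10 * (ι ℓ * ι ℓ) ∎
      where
        open ≤-Reasoning
        0≤S = ∑≤-nonNeg H recip-nonNeg
        S≤1+ℓ = harmonic≤1+log₂ H (ℕP.≤-trans (s≤s z≤n) 2≤H)
        0≤ℓ-1 : 0ℚ ≤ ι ℓ - 1ℚ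
        0≤ℓ-1 = p≤q⇒0≤q-p (ι-mono {1} {ℓ} (⌊log₂⌋-mono-≤ {2} {H} 2≤H))

    ∑⁵-errorBound≤ : ∑ⁿ 5 L (spread (errorBound H) unitPattern) ≤ ι 240 * (ι H * ι H * (ι ℓ * ι ℓ))
    ∑⁵-errorBound≤ = begin
      ∑ⁿ 5 L (spread (errorBound H) unitPattern)
        ≡⟨ ∑⁵-errorBound H L ⟩
      H² * (Ψ′ * (Q′ * (Q′ * Q′)) + Q′ * (Ψ′ * (Q′ * Q′)) + Q′ * (Ψ′ * (Q′ * Q′)))
        ≡⟨ cong (H² *_) (solve 2 (λ p q → p :* (q :* (q :* q)) :+ q :* (p :* (q :* q)) :+ q :* (p :* (q :* q))
                                        := con (ι 3) :* (p :* (q :* (q :* q)))) refl Ψ′ Q′) ⟩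
      H² * (ι 3 * (Ψ′ * (Q′ * (Q′ * Q′))))
        ≤⟨ *-monoˡ-≤-0≤ H² 0≤H² (*-monoˡ-≤-0≤ (ι 3) (ι-nonNeg 3)
             (*-mono-≤-0≤ 0≤Ψ (0≤p*q 0≤Q (0≤p*q 0≤Q 0≤Q)) (≤-trans Ψ≤ [S+2]S+2≤10ℓ²)
               (*-mono-≤-0≤ 0≤Q (0≤p*q 0≤Q 0≤Q) Q≤2 (*-mono-≤-0≤ 0≤Q 0≤Q Q≤2 Q≤2)))) ⟩
      H² * (ι 3 * (ι 10 * (ι ℓ * ι ℓ) * (ι 2 * (ι 2 * ι 2))))
        ≡⟨ solve 2 (λ h l → h :* (con (ι 3) :* (con (ι 10) :* l :* (con (ι 2) :* (con (ι 2) :* con (ι 2)))))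
                          := con (ι 240) :* (h :* l)) refl H² (ι ℓ * ι ℓ) ⟩
      ι 240 * (H² * (ι ℓ * ι ℓ)) ∎
      where
        open ≤-Reasoning
        H² = ι H * ι H
        0≤H² = 0≤p*q (ι-nonNeg H) (ι-nonNeg H)
        Ψ′ = Ψ H L
        Q′ = Q H L

  ∑³∏localFactor≈ : ∀ l → Bounded l → ∀ H → 2 ℕ.≤ H → ∀ L → All Prime L → Unique L →
    ∣ ∑³ H (λ a b c → ∏ L (λ p → localFactor l p a b c)) - ι H * ι H * ι H * ∏ L (localDensity l) ∣
      ≤ ι 240 * (ι H * ι H * (ι ⌊log₂ H ⌋ * ι ⌊log₂ H ⌋))
  ∑³∏localFactor≈ l bounded H 2≤H L pL uL = begin
    ∣ ∑³ H P - ι H * ι H * ι H * ∏ L (localDensity l) ∣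
      ≡⟨ cong₂ (λ x y → ∣ x - y ∣) ∑³≡expand H³≡expand ⟩
    ∣ expand l L (lattice H) unitPattern - expand l L (volume H) unitPattern ∣
      ≡⟨ cong ∣_∣ (sym (expand-− l L (lattice H) (volume H) unitPattern)) ⟩
    ∣ expand l L (λ s → lattice H s - volume H s) unitPattern ∣
      ≤⟨ ∣expand∣≤majorant l bounded L (λ s → lattice H s - volume H s) unitPattern ⟩
    majorant L G unitPattern
      ≤⟨ majorant≤∑⁵ L G (λ s → 0≤∣p∣ _) unitPattern ⟩
    ∑ⁿ 5 L (spread G unitPattern)
      ≤⟨ ∑ⁿ-mono 5 L (λ a b c d e → ∣lattice-volume∣≤errorBound H (mkPattern (1 ℕ.* a) (1 ℕ.* b) (1 ℕ.* c) (1 ℕ.* (d ℕ.* e)))) ⟩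
    ∑ⁿ 5 L (spread (errorBound H) unitPattern)
      ≤⟨ ∑⁵-errorBound≤ H 2≤H L pL uL ⟩
    ι 240 * (ι H * ι H * (ι ⌊log₂ H ⌋ * ι ⌊log₂ H ⌋)) ∎
    where
      open ≤-Reasoning
      P : ℕ → ℕ → ℕ → ℚ
      P a b c = ∏ L (λ p → localFactor l p a b c)
      G : Pattern → ℚ
      G s = ∣ lattice H s - volume H s ∣
      fits-unit : ∀ a b c → fits unitPattern a b c ≡ 1ℚ
      fits-unit a b c = cong₂ _*_ (cong₂ _*_ (𝟙∣-yes (1∣ a)) (𝟙∣-yes (1∣ b))) (𝟙∣-yes (1∣ c))
      ∑³≡expand : ∑³ H P ≡ expand l L (lattice H) unitPattern
      ∑³≡expand = begin-equality
        ∑³ H P                                                ≡⟨ ∑³-cong H (λ a b c → sym (trans (cong (_* P a b c) (fits-unit a b c)) (*-identityˡ _))) ⟩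
        ∑³ H (λ a b c → fits unitPattern a b c * P a b c)     ≡⟨ ∑³-fits*∏localFactor l H L unitPattern pL uL
                                                                   (All.map (λ pp → prime∤1 pp , prime∤1 pp , prime∤1 pp) pL) ⟩
        expand l L (λ t → ∑³ H (fits t)) unitPattern          ≡⟨ expand-cong l L (∑³-fits H) unitPattern ⟩
        expand l L (lattice H) unitPattern                    ∎
      H³≡expand : ι H * ι H * ι H * ∏ L (localDensity l) ≡ expand l L (volume H) unitPattern
      H³≡expand = sym (trans (expand-multiplicative l L (volume H) (volume-pushX H) (volume-pushY H) (volume-pushZ H) (volume-pushW H) unitPattern)
                             (cong (_* ∏ L (localDensity l)) (cong₂ _*_ (cong₂ _*_ (*-identityʳ (ι H)) (*-identityʳ (ι H))) (*-identityʳ (ι H)))))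

module CoprimalityProduct where

  open import Data.Nat as ℕ using (ℕ; zero; suc; s≤s; z≤n; _≡ᵇ_)
  import Data.Nat.Properties as ℕP
  open import Data.Nat.Divisibility using (_∣_; _∣?_; ∣⇒≤; ∣-trans; m∣m*n; 0∣⇒≡0)
  open import Data.Nat.GCD using (gcd; gcd[m,n]∣m; gcd[m,n]∣n; gcd-greatest)
  open import Data.Nat.Primality using (Prime)
  open import Data.Nat.Primality.Factorisation using (factorise)
  open import Data.Rational.Base hiding (_/_)
  open import Data.Rational.Properties
  open import Data.List using (List; []; _∷_)
  open import Data.List.Relation.Unary.All as All using (All; []; _∷_)
  open import Data.List.Relation.Unary.Any using (here; there)
  open import Data.List.Membership.Propositional using (_∈_)
  open import Data.Product using (_,_; _×_; ∃)
  open import Data.Bool using (false)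
  open import Data.Empty using (⊥-elim)
  open import Relation.Nullary using (yes; no)
  open import Relation.Binary.PropositionalEquality
  open FiniteSums
  open Divisibility

  primeDivisor : ∀ n → 2 ℕ.≤ n → ∃ λ p → Prime p × p ∣ n
  primeDivisor n 2≤n with factorise n {{ℕ.>-nonZero (ℕP.≤-trans (s≤s z≤n) 2≤n)}}
  ... | record { factors = [] ; isFactorisation = n≡1 } = ⊥-elim (ℕP.<⇒≢ 2≤n (sym n≡1))
  ... | record { factors = p ∷ _ ; isFactorisation = eq ; factorsPrime = pp ∷ _ } = p , pp , subst (p ∣_) (sym eq) (m∣m*n _)

  ∏-∈-zero : ∀ {A : Set} {L : List A} {f : A → ℚ} {x} → x ∈ L → f x ≡ 0ℚ → ∏ L f ≡ 0ℚ
  ∏-∈-zero {L = _ ∷ L} {f} (here refl) fx≡0 = trans (cong (_* ∏ L f) fx≡0) (*-zeroˡ (∏ L f))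
  ∏-∈-zero {L = y ∷ _} {f} (there x∈L) fx≡0 = trans (cong (f y *_) (∏-∈-zero x∈L fx≡0)) (*-zeroʳ (f y))

  ∏-one : ∀ {A : Set} (L : List A) (f : A → ℚ) → All (λ x → f x ≡ 1ℚ) L → ∏ L f ≡ 1ℚ
  ∏-one [] f [] = refl
  ∏-one (x ∷ L) f (fx≡1 ∷ rest) = trans (cong₂ _*_ fx≡1 (∏-one L f rest)) (*-identityˡ 1ℚ)

  private
    2≤gcd : ∀ {a b} → 1 ℕ.≤ a → gcd a b ≢ 1 → 2 ℕ.≤ gcd a b
    2≤gcd {a} {b} 1≤a = nontrivial (gcd a b) (gcd[m,n]∣m a b)
      where
        nontrivial : ∀ g → g ∣ a → g ≢ 1 → 2 ℕ.≤ g
        nontrivial zero 0∣a _ = ⊥-elim (ℕP.<⇒≢ 1≤a (sym (0∣⇒≡0 0∣a)))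
        nontrivial (suc zero) _ ≢1 = ⊥-elim (≢1 refl)
        nontrivial (suc (suc _)) _ _ = s≤s (s≤s z≤n)

    ≢1⇒≡ᵇ1-false : ∀ {m} → m ≢ 1 → (m ≡ᵇ 1) ≡ false
    ≢1⇒≡ᵇ1-false {zero} _ = refl
    ≢1⇒≡ᵇ1-false {suc zero} ≢1 = ⊥-elim (≢1 refl)
    ≢1⇒≡ᵇ1-false {suc (suc _)} _ = refl

  𝟙coprime≡∏ : ∀ H L → All Prime L → (∀ p → Prime p → p ℕ.≤ H → p ∈ L) → ∀ a b → 1 ℕ.≤ a → a ℕ.≤ H →
               χ (gcd a b ≡ᵇ 1) ≡ ∏ L (λ p → 1ℚ - 𝟙[ p ∣ a ] * 𝟙[ p ∣ b ])
  𝟙coprime≡∏ H L pL covers a b 1≤a a≤H with gcd a b ℕ.≟ 1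
  ... | yes g≡1 = trans (cong (λ g → χ (g ≡ᵇ 1)) g≡1) (sym (∏-one L _ (All.map noCommonFactor pL)))
    where
      noCommonFactor : ∀ {p} → Prime p → 1ℚ - 𝟙[ p ∣ a ] * 𝟙[ p ∣ b ] ≡ 1ℚ
      noCommonFactor {p} pp with p ∣? a | p ∣? b
      ... | yes p∣a | yes p∣b = ⊥-elim (prime∤1 pp (subst (p ∣_) g≡1 (gcd-greatest p∣a p∣b)))
      ... | yes _   | no _    = refl
      ... | no _    | yes _   = refl
      ... | no _    | no _    = refl
  ... | no g≢1 with primeDivisor (gcd a b) (2≤gcd 1≤a g≢1)
  ...   | p , pp , p∣g = trans (cong χ (≢1⇒≡ᵇ1-false g≢1)) (sym (∏-∈-zero (covers p pp p≤H) local≡0))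
    where
      p∣a = ∣-trans p∣g (gcd[m,n]∣m a b)
      p∣b = ∣-trans p∣g (gcd[m,n]∣n a b)
      p≤H : p ℕ.≤ H
      p≤H = ℕP.≤-trans (∣⇒≤ {{ℕ.>-nonZero 1≤a}} p∣a) a≤H
      local≡0 : 1ℚ - 𝟙[ p ∣ a ] * 𝟙[ p ∣ b ] ≡ 0ℚ
      local≡0 = cong₂ (λ x y → 1ℚ - x * y) (𝟙∣-yes p∣a) (𝟙∣-yes p∣b)

module InclusionExclusion where

  open import Data.Nat as ℕ using (ℕ; zero; suc; _≡ᵇ_)
  open import Data.Nat.Divisibility using (_∣?_)
  open import Data.Nat.GCD using (gcd)
  open import Data.Nat.ListAction using (sum)
  open import Data.Nat.Logarithm using (⌊log₂_⌋)
  open import Data.Nat.Primality using (Prime)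
  open import Data.Bool using (Bool; true; false; not; _∧_)
  open import Data.Rational.Base hiding (_/_)
  open import Data.Rational.Properties
  open import Data.Rational.Solver
  open import Data.List using (List; []; _∷_; _∷ʳ_; map)
  open import Data.List.Properties using (applyUpTo-∷ʳ)
  import Data.List.Relation.Unary.All as All
  open import Data.List.Relation.Unary.Unique.Propositional using (Unique)
  open import Data.List.Membership.Propositional using (_∈_)
  open import Data.Product using (_,_; _×_; proj₂)
  open import Relation.Nullary.Decidable using (Dec; isYes; toWitness; _×-dec_)
  open import Relation.Binary.PropositionalEquality
  open import Defs using (range1; pnc3; ind; N3)
  open +-*-Solver
  open Rationals
  open FiniteSums
  open Divisibility
  open EulerExpansion using (Coeffs; coeffs; cX; cY; cZ; cW; localFactor; localDensity; Bounded)
  open CoprimalityProduct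
  open LocalFactorEstimate

  κ₀ κᵃᵇ κᵃᶜ κᵇᶜ κᵃ κᵇ κᶜ κᵃᵇᶜ : Coeffs
  κ₀ = coeffs 0ℚ 0ℚ 0ℚ 0ℚ
  κᵃᵇ = coeffs (- 1ℚ) 0ℚ 0ℚ 0ℚ
  κᵃᶜ = coeffs 0ℚ (- 1ℚ) 0ℚ 0ℚ
  κᵇᶜ = coeffs 0ℚ 0ℚ (- 1ℚ) 0ℚ
  κᵃ = coeffs (- 1ℚ) (- 1ℚ) 0ℚ 1ℚ
  κᵇ = coeffs (- 1ℚ) 0ℚ (- 1ℚ) 1ℚ
  κᶜ = coeffs 0ℚ (- 1ℚ) (- 1ℚ) 1ℚ
  κᵃᵇᶜ = coeffs (- 1ℚ) (- 1ℚ) (- 1ℚ) (ι 2)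

  -- Expanding (1 - Cᵃᵇ)(1 - Cᵃᶜ)(1 - Cᵇᶜ), where Cˣʸ is the coprimality indicator of x and y;
  -- e.g. κᵃ is the local factor of Cᵃᵇ Cᵃᶜ and κᵃᵇᶜ that of Cᵃᵇ Cᵃᶜ Cᵇᶜ.
  expansion : List (ℚ × Coeffs)
  expansion = (1ℚ , κ₀) ∷ (- 1ℚ , κᵃᵇ) ∷ (- 1ℚ , κᵃᶜ) ∷ (- 1ℚ , κᵇᶜ)
              ∷ (1ℚ , κᵃ) ∷ (1ℚ , κᵇ) ∷ (1ℚ , κᶜ) ∷ (- 1ℚ , κᵃᵇᶜ) ∷ []

  combine : (Coeffs → ℚ) → ℚ
  combine F = ∑ expansion (λ (ε , κ) → ε * F κ)

  private
    by-cases : ∀ {P : Bool → Bool → Bool → Set} →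
               P true true true → P true true false → P true false true → P true false false →
               P false true true → P false true false → P false false true → P false false false →
               ∀ u v w → P u v w
    by-cases ttt _ _ _ _ _ _ _ true true true = ttt
    by-cases _ ttf _ _ _ _ _ _ true true false = ttf
    by-cases _ _ tft _ _ _ _ _ true false true = tft
    by-cases _ _ _ tff _ _ _ _ true false false = tff
    by-cases _ _ _ _ ftt _ _ _ false true true = ftt
    by-cases _ _ _ _ _ ftf _ _ false true false = ftf
    by-cases _ _ _ _ _ _ fft _ false false true = fft
    by-cases _ _ _ _ _ _ _ fff false false false = fff

    localᴮ : Coeffs → Bool → Bool → Bool → ℚ
    localᴮ l u v w = 1ℚ + cX l * (χ u * χ v) + cY l * (χ u * χ w) + cZ l * (χ v * χ w) + cW l * (χ u * χ v * χ w)

    coprimeᴮ : Bool → Bool → ℚ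
    coprimeᴮ u v = 1ℚ - χ u * χ v

    local-κ₀ : ∀ u v w → localᴮ κ₀ u v w ≡ 1ℚ
    local-κ₀ = by-cases refl refl refl refl refl refl refl refl
    local-κᵃᵇ : ∀ u v w → localᴮ κᵃᵇ u v w ≡ coprimeᴮ u v
    local-κᵃᵇ = by-cases refl refl refl refl refl refl refl refl
    local-κᵃᶜ : ∀ u v w → localᴮ κᵃᶜ u v w ≡ coprimeᴮ u w
    local-κᵃᶜ = by-cases refl refl refl refl refl refl refl refl
    local-κᵇᶜ : ∀ u v w → localᴮ κᵇᶜ u v w ≡ coprimeᴮ v w
    local-κᵇᶜ = by-cases refl refl refl refl refl refl refl refl
    local-κᵃ : ∀ u v w → localᴮ κᵃ u v w ≡ coprimeᴮ u v * coprimeᴮ u w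
    local-κᵃ = by-cases refl refl refl refl refl refl refl refl
    local-κᵇ : ∀ u v w → localᴮ κᵇ u v w ≡ coprimeᴮ u v * coprimeᴮ v w
    local-κᵇ = by-cases refl refl refl refl refl refl refl refl
    local-κᶜ : ∀ u v w → localᴮ κᶜ u v w ≡ coprimeᴮ u w * coprimeᴮ v w
    local-κᶜ = by-cases refl refl refl refl refl refl refl refl
    local-κᵃᵇᶜ : ∀ u v w → localᴮ κᵃᵇᶜ u v w ≡ coprimeᴮ u v * coprimeᴮ u w * coprimeᴮ v w
    local-κᵃᵇᶜ = by-cases refl refl refl refl refl refl refl refl

    ι-ind-pnc3 : ∀ x y z → ι (ind (not x ∧ (not y ∧ not z))) ≡ (1ℚ - χ x) * ((1ℚ - χ y) * (1ℚ - χ z))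
    ι-ind-pnc3 = by-cases refl refl refl refl refl refl refl refl

  ∏-expansion : ∀ L a b c →
    let Eᵃᵇ = ∏ L (λ p → 1ℚ - 𝟙[ p ∣ a ] * 𝟙[ p ∣ b ])
        Eᵃᶜ = ∏ L (λ p → 1ℚ - 𝟙[ p ∣ a ] * 𝟙[ p ∣ c ])
        Eᵇᶜ = ∏ L (λ p → 1ℚ - 𝟙[ p ∣ b ] * 𝟙[ p ∣ c ])
    in (1ℚ - Eᵃᵇ) * ((1ℚ - Eᵃᶜ) * (1ℚ - Eᵇᶜ)) ≡ combine (λ κ → ∏ L (λ p → localFactor κ p a b c))
  ∏-expansion L a b c = begin
    (1ℚ - Eᵃᵇ) * ((1ℚ - Eᵃᶜ) * (1ℚ - Eᵇᶜ))
      ≡⟨ solve 3 (λ x y z → (con 1ℚ :- x) :* ((con 1ℚ :- y) :* (con 1ℚ :- z))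
                  := con 1ℚ :* con 1ℚ :+ (:- con 1ℚ :* x :+ (:- con 1ℚ :* y :+ (:- con 1ℚ :* z :+ (con 1ℚ :* (x :* y)
                     :+ (con 1ℚ :* (x :* z) :+ (con 1ℚ :* (y :* z) :+ (:- con 1ℚ :* (x :* y :* z) :+ con 0ℚ))))))))
               refl Eᵃᵇ Eᵃᶜ Eᵇᶜ ⟩
    1ℚ * 1ℚ + (- 1ℚ * Eᵃᵇ + (- 1ℚ * Eᵃᶜ + (- 1ℚ * Eᵇᶜ + (1ℚ * (Eᵃᵇ * Eᵃᶜ) + (1ℚ * (Eᵃᵇ * Eᵇᶜ)
      + (1ℚ * (Eᵃᶜ * Eᵇᶜ) + (- 1ℚ * (Eᵃᵇ * Eᵃᶜ * Eᵇᶜ) + 0ℚ)))))))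
      ≡⟨ sym (cong₂ _+_ (cong (1ℚ *_) e₀) (cong₂ _+_ (cong (- 1ℚ *_) eᵃᵇ) (cong₂ _+_ (cong (- 1ℚ *_) eᵃᶜ)
               (cong₂ _+_ (cong (- 1ℚ *_) eᵇᶜ) (cong₂ _+_ (cong (1ℚ *_) eᵃ) (cong₂ _+_ (cong (1ℚ *_) eᵇ)
               (cong₂ _+_ (cong (1ℚ *_) eᶜ) (cong (λ t → - 1ℚ * t + 0ℚ) eᵃᵇᶜ)))))))) ⟩
    combine W ∎
    where
      open ≡-Reasoning
      W : Coeffs → ℚ
      W κ = ∏ L (λ p → localFactor κ p a b c)
      u v w : ℕ → Bool
      u p = isYes (p ∣? a)
      v p = isYes (p ∣? b)
      w p = isYes (p ∣? c)
      Eᵃᵇ = ∏ L (λ p → coprimeᴮ (u p) (v p))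
      Eᵃᶜ = ∏ L (λ p → coprimeᴮ (u p) (w p))
      Eᵇᶜ = ∏ L (λ p → coprimeᴮ (v p) (w p))
      e₀ : W κ₀ ≡ 1ℚ
      e₀ = ∏-one L _ (All.tabulate (λ {p} _ → local-κ₀ (u p) (v p) (w p)))
      eᵃᵇ : W κᵃᵇ ≡ Eᵃᵇ
      eᵃᵇ = ∏-cong L (λ p → local-κᵃᵇ (u p) (v p) (w p))
      eᵃᶜ : W κᵃᶜ ≡ Eᵃᶜ
      eᵃᶜ = ∏-cong L (λ p → local-κᵃᶜ (u p) (v p) (w p))
      eᵇᶜ : W κᵇᶜ ≡ Eᵇᶜ
      eᵇᶜ = ∏-cong L (λ p → local-κᵇᶜ (u p) (v p) (w p))
      eᵃ : W κᵃ ≡ Eᵃᵇ * Eᵃᶜ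
      eᵃ = trans (∏-cong L (λ p → local-κᵃ (u p) (v p) (w p))) (∏-* L _ _)
      eᵇ : W κᵇ ≡ Eᵃᵇ * Eᵇᶜ
      eᵇ = trans (∏-cong L (λ p → local-κᵇ (u p) (v p) (w p))) (∏-* L _ _)
      eᶜ : W κᶜ ≡ Eᵃᶜ * Eᵇᶜ
      eᶜ = trans (∏-cong L (λ p → local-κᶜ (u p) (v p) (w p))) (∏-* L _ _)
      eᵃᵇᶜ : W κᵃᵇᶜ ≡ Eᵃᵇ * Eᵃᶜ * Eᵇᶜ
      eᵃᵇᶜ = trans (∏-cong L (λ p → local-κᵃᵇᶜ (u p) (v p) (w p))) (trans (∏-* L _ _) (cong (_* Eᵇᶜ) (∏-* L _ _)))

  module _ (H : ℕ) (L : List ℕ) (pL : All.All Prime L) (covers : ∀ p → Prime p → p ℕ.≤ H → p ∈ L) where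

    ι-ind-pnc3≡combine : ∀ a b c → 1 ℕ.≤ a → a ℕ.≤ H → 1 ℕ.≤ b → b ℕ.≤ H →
                         ι (ind (pnc3 a b c)) ≡ combine (λ κ → ∏ L (λ p → localFactor κ p a b c))
    ι-ind-pnc3≡combine a b c 1≤a a≤H 1≤b b≤H = begin
      ι (ind (pnc3 a b c))
        ≡⟨ ι-ind-pnc3 (gcd a b ≡ᵇ 1) (gcd a c ≡ᵇ 1) (gcd b c ≡ᵇ 1) ⟩
      (1ℚ - χ (gcd a b ≡ᵇ 1)) * ((1ℚ - χ (gcd a c ≡ᵇ 1)) * (1ℚ - χ (gcd b c ≡ᵇ 1)))
        ≡⟨ cong₂ (λ x (y , z) → (1ℚ - x) * ((1ℚ - y) * (1ℚ - z))) (coprime a b 1≤a a≤H)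
                 (cong₂ _,_ (coprime a c 1≤a a≤H) (coprime b c 1≤b b≤H)) ⟩
      _ ≡⟨ ∏-expansion L a b c ⟩
      combine (λ κ → ∏ L (λ p → localFactor κ p a b c)) ∎
      where
        open ≡-Reasoning
        coprime = 𝟙coprime≡∏ H L pL covers

  ∑³-combine : ∀ H (W : Coeffs → ℕ → ℕ → ℕ → ℚ) → ∑³ H (λ a b c → combine (λ κ → W κ a b c)) ≡ combine (λ κ → ∑³ H (W κ))
  ∑³-combine H W = trans (∑³-∑ H expansion (λ (ε , κ) a b c → ε * W κ a b c))
                         (∑-cong expansion (λ (ε , κ) → ∑³-*ˡ H ε (W κ)))

  combine-*ʳ : ∀ F h → combine F * h ≡ combine (λ κ → h * F κ)
  combine-*ʳ F h = trans (sym (∑-*ʳ expansion h (λ (ε , κ) → ε * F κ)))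
    (∑-cong expansion (λ (ε , κ) → solve 3 (λ e f h → e :* f :* h := e :* (h :* f)) refl ε (F κ) h))

  ∣combine-combine∣≤ : ∀ F G B → (∀ κ → Bounded κ → ∣ F κ - G κ ∣ ≤ B) → ∣ combine F - combine G ∣ ≤ ι 8 * B
  ∣combine-combine∣≤ F G B close = begin
    ∣ combine F - combine G ∣
      ≡⟨ cong ∣_∣ (sym (trans (∑-cong expansion (λ (ε , κ) → trans (*-distribˡ-+ ε (F κ) (- G κ)) (cong (ε * F κ +_) (sym (neg-distribʳ-* ε (G κ))))))
                              (∑-− expansion (λ (ε , κ) → ε * F κ) (λ (ε , κ) → ε * G κ)))) ⟩
    ∣ ∑ expansion (λ (ε , κ) → ε * (F κ - G κ)) ∣
      ≤⟨ ∣∑∣≤∑∣∣ expansion (λ (ε , κ) → ε * (F κ - G κ)) ⟩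
    ∑ expansion (λ (ε , κ) → ∣ ε * (F κ - G κ) ∣)
      ≤⟨ ∑-mono-All (All.map (λ {x} (∣ε∣≤1 , bounded) → term≤ ∣ε∣≤1 (close (proj₂ x) bounded)) admissible) ⟩
    ∑ expansion (λ _ → B)
      ≡⟨ solve 1 (λ b → b :+ (b :+ (b :+ (b :+ (b :+ (b :+ (b :+ (b :+ con 0ℚ))))))) := con (ι 8) :* b) refl B ⟩
    ι 8 * B ∎
    where
      open ≤-Reasoning
      bounded? : ∀ κ → Dec (Bounded κ)
      bounded? κ = (∣ cX κ ∣ ≤? 1ℚ) ×-dec ((∣ cY κ ∣ ≤? 1ℚ) ×-dec ((∣ cZ κ ∣ ≤? 1ℚ) ×-dec (∣ cW κ ∣ ≤? ι 2)))
      admissible : All.All (λ (ε , κ) → ∣ ε ∣ ≤ 1ℚ × Bounded κ) expansion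
      admissible = toWitness {a? = All.all? (λ (ε , κ) → (∣ ε ∣ ≤? 1ℚ) ×-dec bounded? κ) expansion} _
      term≤ : ∀ {ε d} → ∣ ε ∣ ≤ 1ℚ → ∣ d ∣ ≤ B → ∣ ε * d ∣ ≤ B
      term≤ {ε} {d} ∣ε∣≤1 ∣d∣≤B = begin
        ∣ ε * d ∣       ≡⟨ ∣p*q∣≡∣p∣*∣q∣ ε d ⟩
        ∣ ε ∣ * ∣ d ∣   ≤⟨ *-mono-≤-0≤ (0≤∣p∣ ε) (0≤∣p∣ d) ∣ε∣≤1 ∣d∣≤B ⟩
        1ℚ * B          ≡⟨ *-identityˡ B ⟩
        B               ∎

  private
    ι-sum : ∀ (xs : List ℕ) (f : ℕ → ℕ) → ι (sum (map f xs)) ≡ ∑ xs (λ x → ι (f x))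
    ι-sum [] f = refl
    ι-sum (x ∷ xs) f = trans (ι-+ (f x) (sum (map f xs))) (cong (ι (f x) +_) (ι-sum xs f))

    ∑-range1 : ∀ H f → ∑ (range1 H) f ≡ ∑≤ H f
    ∑-range1 zero f = refl
    ∑-range1 (suc H) f = begin
      ∑ (range1 (suc H)) f                   ≡⟨ cong (λ xs → ∑ xs f) (sym (applyUpTo-∷ʳ suc H)) ⟩
      ∑ (range1 H ∷ʳ suc H) f                ≡⟨ ∑-++ (range1 H) (suc H ∷ []) f ⟩
      ∑ (range1 H) f + (f (suc H) + 0ℚ)      ≡⟨ cong₂ _+_ (∑-range1 H f) (+-identityʳ (f (suc H))) ⟩
      ∑≤ H f + f (suc H)                     ≡⟨ +-comm (∑≤ H f) (f (suc H)) ⟩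
      ∑≤ (suc H) f                           ∎
      where open ≡-Reasoning

    ι-N3 : ∀ H → ι (N3 H) ≡ ∑³ H (λ a b c → ι (ind (pnc3 a b c)))
    ι-N3 H = trans (ι-sum (range1 H) _) (trans (∑-range1 H _) (∑-cong (downFrom₁ H) (λ a →
               trans (ι-sum (range1 H) _) (trans (∑-range1 H _) (∑-cong (downFrom₁ H) (λ b →
                 trans (ι-sum (range1 H) _) (∑-range1 H _)))))))

  N3≈ : ∀ H → 2 ℕ.≤ H → ∀ L → All.All Prime L → Unique L → (∀ p → Prime p → p ℕ.≤ H → p ∈ L) →
        ∣ ι (N3 H) - combine (λ κ → ∏ L (localDensity κ)) * (ι H * ι H * ι H) ∣
          ≤ ι 8 * (ι 240 * (ι H * ι H * (ι ⌊log₂ H ⌋ * ι ⌊log₂ H ⌋)))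
  N3≈ H 2≤H L pL uL covers = begin
    ∣ ι (N3 H) - combine (λ κ → ∏ L (localDensity κ)) * (ι H * ι H * ι H) ∣
      ≡⟨ cong₂ (λ x y → ∣ x - y ∣) N3≡combine (combine-*ʳ (λ κ → ∏ L (localDensity κ)) (ι H * ι H * ι H)) ⟩
    ∣ combine (λ κ → ∑³ H (W κ)) - combine (λ κ → ι H * ι H * ι H * ∏ L (localDensity κ)) ∣
      ≤⟨ ∣combine-combine∣≤ (λ κ → ∑³ H (W κ)) (λ κ → ι H * ι H * ι H * ∏ L (localDensity κ)) _ (λ κ bounded → ∑³∏localFactor≈ κ bounded H 2≤H L pL uL) ⟩
    ι 8 * (ι 240 * (ι H * ι H * (ι ⌊log₂ H ⌋ * ι ⌊log₂ H ⌋))) ∎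
    where
      open ≤-Reasoning
      W : Coeffs → ℕ → ℕ → ℕ → ℚ
      W κ a b c = ∏ L (λ p → localFactor κ p a b c)
      N3≡combine : ι (N3 H) ≡ combine (λ κ → ∑³ H (W κ))
      N3≡combine = trans (ι-N3 H) (trans (∑³-congᴴ H (λ a b c 1≤a a≤H 1≤b b≤H → ι-ind-pnc3≡combine H L pL covers a b c 1≤a a≤H 1≤b b≤H))
                                         (∑³-combine H W))

module Unnormalised where

  open import Data.Nat as ℕ using (ℕ; zero; suc; s≤s; z≤n)
  import Data.Nat.Properties as ℕP
  open import Data.Nat.Primality using (Prime; prime?; ¬prime[0])
  import Data.Nat.Tactic.RingSolver as ℕ-Solver
  open import Data.Integer as ℤ using (+_)
  import Data.Integer.Properties as ℤP
  open import Data.Integer.Tactic.RingSolver using (solve-∀)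
  open import Data.Rational.Base as ℚ using (ℚ; 0ℚ; 1ℚ; toℚᵘ)
  open import Data.Rational.Properties as ℚP using (toℚᵘ-homo-+; toℚᵘ-homo-*; toℚᵘ-homo‿-)
  open import Data.Rational.Solver
  open import Data.Rational.Unnormalised.Base as ℚᵘ using (ℚᵘ; mkℚᵘ; _≃_; *≡*)
  import Data.Rational.Unnormalised.Properties as ℚᵘP
  open import Data.List using ([]; _∷_; foldr)
  open import Data.List.Relation.Unary.All as All using (All; []; _∷_)
  import Data.List.Relation.Unary.All.Properties as AllP
  open import Data.List.Relation.Unary.Unique.Propositional using (Unique)
  import Data.List.Relation.Unary.Unique.Propositional.Properties as UniqueP
  open import Data.List.Membership.Propositional using (_∈_)
  open import Data.List.Membership.Propositional.Properties using (∈-filter⁺; ∈-applyUpTo⁺)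
  open import Data.Empty using (⊥-elim)
  open import Data.Product using (_,_; _×_; proj₁; proj₂)
  open import Relation.Binary.PropositionalEquality
  open import Defs using (ℕ→ℚ; frac; range1; primesUpTo; ρTrunc; fac₁; fac₂; fac₃; N3)
  open import Data.Nat.Logarithm using (⌊log₂_⌋)
  open +-*-Solver
  open Rationals
  open FiniteSums
  open EulerExpansion using (localDensity; cX; cY; cZ; cW)
  open CoprimalityProduct using (∏-one)
  open InclusionExclusion

  toℚᵘ-ι : ∀ n → toℚᵘ (ι n) ≃ ℕ→ℚ n
  toℚᵘ-ι zero = *≡* refl
  toℚᵘ-ι (suc n) = ℚᵘP.≃-trans (toℚᵘ-homo-+ 1ℚ (ι n)) (ℚᵘP.≃-trans (ℚᵘP.+-congʳ (toℚᵘ 1ℚ) (toℚᵘ-ι n)) (*≡* (1+n (+ n))))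
    where
      1+n : ∀ x → (+ 1 ℤ.* + 1 ℤ.+ x ℤ.* + 1) ℤ.* + 1 ≡ (+ 1 ℤ.+ x) ℤ.* (+ 1 ℤ.* + 1)
      1+n = solve-∀

  toℚᵘ-recip : ∀ n → toℚᵘ (recip (suc n)) ≃ mkℚᵘ (+ 1) n
  toℚᵘ-recip n = ℚᵘP.≃-trans (ℚᵘP.≃-reflexive (cong toℚᵘ (sym x≡recip))) (ℚP.toℚᵘ-fromℚᵘ 1/[1+n])
    where
      1/[1+n] = mkℚᵘ (+ 1) n
      x = ℚ.fromℚᵘ 1/[1+n]
      [1+n]*1/[1+n] : ℕ→ℚ (suc n) ℚᵘ.* 1/[1+n] ≃ ℚᵘ.1ℚᵘ
      [1+n]*1/[1+n] = *≡* (cong (λ t → + suc t) (unfold-* n))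
        where
          unfold-* : ∀ n → n ℕ.* 1 ℕ.* 1 ≡ n ℕ.+ 0 ℕ.* suc n ℕ.+ 0 ℕ.* suc (n ℕ.+ 0 ℕ.* suc n)
          unfold-* = ℕ-Solver.solve-∀
      x≡recip : x ≡ recip (suc n)
      x≡recip = recip-unique n x (ℚP.toℚᵘ-injective
        (ℚᵘP.≃-trans (toℚᵘ-homo-* (ι (suc n)) x)
          (ℚᵘP.≃-trans (ℚᵘP.*-cong (toℚᵘ-ι (suc n)) (ℚP.toℚᵘ-fromℚᵘ 1/[1+n])) (ℚᵘP.≃-trans [1+n]*1/[1+n] (*≡* refl)))))

  toℚᵘ-frac : ∀ m n → toℚᵘ (ι m ℚ.* recip (suc n)) ≃ frac m (suc n)
  toℚᵘ-frac m n = ℚᵘP.≃-trans (toℚᵘ-homo-* (ι m) (recip (suc n))) (ℚᵘP.≃-trans (ℚᵘP.*-cong (toℚᵘ-ι m) (toℚᵘ-recip n))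
    (*≡* (trans (cong (ℤ._* + suc n) (ℤP.*-identityʳ (+ m))) (cong (+ m ℤ.*_) (cong +_ (sym (ℕP.*-identityˡ (suc n))))))))

  toℚᵘ-1- : ∀ x → toℚᵘ (1ℚ ℚ.- x) ≃ ℚᵘ.1ℚᵘ ℚᵘ.- toℚᵘ x
  toℚᵘ-1- x = ℚᵘP.≃-trans (toℚᵘ-homo-+ 1ℚ (ℚ.- x)) (ℚᵘP.+-cong {toℚᵘ 1ℚ} {ℚᵘ.1ℚᵘ} (*≡* refl) (toℚᵘ-homo‿- x))

  module _ (p′ : ℕ) where

    private
      p = suc p′
      r = recip p
      r² = recip (p ℕ.* p)
      r²≡ : recip² p ≡ r²
      r²≡ = sym (recip-* p p)
      r³≡ : recip³ p ≡ r² ℚ.* r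
      r³≡ = cong (ℚ._* r) r²≡
      pr≡1 : ι p ℚ.* r ≡ 1ℚ
      pr≡1 = ι*recip p′

    localDensity-κᵃᵇ : localDensity κᵃᵇ (suc p′) ≡ 1ℚ ℚ.- ι 1 ℚ.* recip (suc p′ ℕ.* suc p′)
    localDensity-κᵃᵇ = trans (cong₂ (λ x y → 1ℚ ℚ.+ ℚ.- 1ℚ ℚ.* x ℚ.+ 0ℚ ℚ.* x ℚ.+ 0ℚ ℚ.* x ℚ.+ 0ℚ ℚ.* y) r²≡ r³≡)
      (solve 2 (λ x y → con 1ℚ :+ :- con 1ℚ :* x :+ con 0ℚ :* x :+ con 0ℚ :* x :+ con 0ℚ :* y := con 1ℚ :- con 1ℚ :* x) refl r² (r² ℚ.* r))

    localDensity-κᵃ : localDensity κᵃ (suc p′) ≡ 1ℚ ℚ.- ι (2 ℕ.* suc p′ ℕ.∸ 1) ℚ.* recip (suc p′ ℕ.* suc p′ ℕ.* suc p′)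
    localDensity-κᵃ = begin
      localDensity κᵃ p
        ≡⟨ cong₂ (λ x y → 1ℚ ℚ.+ ℚ.- 1ℚ ℚ.* x ℚ.+ ℚ.- 1ℚ ℚ.* x ℚ.+ 0ℚ ℚ.* x ℚ.+ 1ℚ ℚ.* y) r²≡ r³≡ ⟩
      1ℚ ℚ.+ ℚ.- 1ℚ ℚ.* r² ℚ.+ ℚ.- 1ℚ ℚ.* r² ℚ.+ 0ℚ ℚ.* r² ℚ.+ 1ℚ ℚ.* (r² ℚ.* r)
        ≡⟨ solve 3 (λ x r a → con 1ℚ :+ :- con 1ℚ :* x :+ :- con 1ℚ :* x :+ con 0ℚ :* x :+ con 1ℚ :* (x :* r)
                     := con 1ℚ :- (con (ι 2) :* a :- con 1ℚ) :* (x :* r) :- con (ι 2) :* x :* (con 1ℚ :- a :* r))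
             refl r² r (ι p) ⟩
      1ℚ ℚ.- (ι 2 ℚ.* ι p ℚ.- 1ℚ) ℚ.* (r² ℚ.* r) ℚ.- ι 2 ℚ.* r² ℚ.* (1ℚ ℚ.- ι p ℚ.* r)
        ≡⟨ cong (λ t → 1ℚ ℚ.- (ι 2 ℚ.* ι p ℚ.- 1ℚ) ℚ.* (r² ℚ.* r) ℚ.- ι 2 ℚ.* r² ℚ.* (1ℚ ℚ.- t)) pr≡1 ⟩
      1ℚ ℚ.- (ι 2 ℚ.* ι p ℚ.- 1ℚ) ℚ.* (r² ℚ.* r) ℚ.- ι 2 ℚ.* r² ℚ.* (1ℚ ℚ.- 1ℚ)
        ≡⟨ solve 2 (λ s t → con 1ℚ :- s :- t :* (con 1ℚ :- con 1ℚ) := con 1ℚ :- s) refl ((ι 2 ℚ.* ι p ℚ.- 1ℚ) ℚ.* (r² ℚ.* r)) (ι 2 ℚ.* r²) ⟩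
      1ℚ ℚ.- (ι 2 ℚ.* ι p ℚ.- 1ℚ) ℚ.* (r² ℚ.* r)
        ≡⟨ cong₂ (λ s t → 1ℚ ℚ.- s ℚ.* t) (sym (trans (ι-∸ (ℕP.≤-trans (s≤s z≤n) (ℕP.m≤m+n p (p ℕ.+ 0)))) (cong (ℚ._- 1ℚ) (ι-* 2 p))))
                                          (sym (recip-* (p ℕ.* p) p)) ⟩
      1ℚ ℚ.- ι (2 ℕ.* p ℕ.∸ 1) ℚ.* recip (p ℕ.* p ℕ.* p) ∎
      where open ≡-Reasoning

    localDensity-κᵃᵇᶜ : localDensity κᵃᵇᶜ (suc p′) ≡ 1ℚ ℚ.- ι (3 ℕ.* suc p′ ℕ.∸ 2) ℚ.* recip (suc p′ ℕ.* suc p′ ℕ.* suc p′)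
    localDensity-κᵃᵇᶜ = begin
      localDensity κᵃᵇᶜ p
        ≡⟨ cong₂ (λ x y → 1ℚ ℚ.+ ℚ.- 1ℚ ℚ.* x ℚ.+ ℚ.- 1ℚ ℚ.* x ℚ.+ ℚ.- 1ℚ ℚ.* x ℚ.+ ι 2 ℚ.* y) r²≡ r³≡ ⟩
      1ℚ ℚ.+ ℚ.- 1ℚ ℚ.* r² ℚ.+ ℚ.- 1ℚ ℚ.* r² ℚ.+ ℚ.- 1ℚ ℚ.* r² ℚ.+ ι 2 ℚ.* (r² ℚ.* r)
        ≡⟨ solve 3 (λ x r a → con 1ℚ :+ :- con 1ℚ :* x :+ :- con 1ℚ :* x :+ :- con 1ℚ :* x :+ con (ι 2) :* (x :* r)
                     := con 1ℚ :- (con (ι 3) :* a :- con (ι 2)) :* (x :* r) :- con (ι 3) :* x :* (con 1ℚ :- a :* r))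
             refl r² r (ι p) ⟩
      1ℚ ℚ.- (ι 3 ℚ.* ι p ℚ.- ι 2) ℚ.* (r² ℚ.* r) ℚ.- ι 3 ℚ.* r² ℚ.* (1ℚ ℚ.- ι p ℚ.* r)
        ≡⟨ cong (λ t → 1ℚ ℚ.- (ι 3 ℚ.* ι p ℚ.- ι 2) ℚ.* (r² ℚ.* r) ℚ.- ι 3 ℚ.* r² ℚ.* (1ℚ ℚ.- t)) pr≡1 ⟩
      1ℚ ℚ.- (ι 3 ℚ.* ι p ℚ.- ι 2) ℚ.* (r² ℚ.* r) ℚ.- ι 3 ℚ.* r² ℚ.* (1ℚ ℚ.- 1ℚ)
        ≡⟨ solve 2 (λ s t → con 1ℚ :- s :- t :* (con 1ℚ :- con 1ℚ) := con 1ℚ :- s) refl ((ι 3 ℚ.* ι p ℚ.- ι 2) ℚ.* (r² ℚ.* r)) (ι 3 ℚ.* r²) ⟩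
      1ℚ ℚ.- (ι 3 ℚ.* ι p ℚ.- ι 2) ℚ.* (r² ℚ.* r)
        ≡⟨ cong₂ (λ s t → 1ℚ ℚ.- s ℚ.* t) (sym (trans (ι-∸ 2≤3p) (cong (ℚ._- ι 2) (ι-* 3 p)))) (sym (recip-* (p ℕ.* p) p)) ⟩
      1ℚ ℚ.- ι (3 ℕ.* p ℕ.∸ 2) ℚ.* recip (p ℕ.* p ℕ.* p) ∎
      where
        open ≡-Reasoning
        2≤3p : 2 ℕ.≤ 3 ℕ.* p
        2≤3p = ℕP.+-mono-≤ {1} {p} (s≤s z≤n) (ℕP.≤-trans (s≤s z≤n) (ℕP.m≤m+n p (p ℕ.+ 0)))

  toℚᵘ-∏ : ∀ L (g : ℕ → ℚ) (f : ℕ → ℚᵘ) → All Prime L → (∀ p′ → toℚᵘ (g (suc p′)) ≃ f (suc p′)) →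
           toℚᵘ (∏ L g) ≃ foldr (λ p acc → f p ℚᵘ.* acc) ℚᵘ.1ℚᵘ L
  toℚᵘ-∏ [] g f [] _ = *≡* refl
  toℚᵘ-∏ (zero ∷ L) g f (prime0 ∷ _) _ = ⊥-elim (¬prime[0] prime0)
  toℚᵘ-∏ (suc p′ ∷ L) g f (_ ∷ pL) g≃f = ℚᵘP.≃-trans (toℚᵘ-homo-* (g (suc p′)) (∏ L g)) (ℚᵘP.*-cong (g≃f p′) (toℚᵘ-∏ L g f pL g≃f))

  private
    localDensity≡ : ∀ l q → localDensity l q ≡ 1ℚ ℚ.+ (cX l ℚ.+ cY l ℚ.+ cZ l) ℚ.* recip² q ℚ.+ cW l ℚ.* recip³ q
    localDensity≡ l q = solve 6 (λ a b c d x y → con 1ℚ :+ a :* x :+ b :* x :+ c :* x :+ d :* y := con 1ℚ :+ (a :+ b :+ c) :* x :+ d :* y)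
                          refl (cX l) (cY l) (cZ l) (cW l) (recip² q) (recip³ q)

    ∏-same-density : ∀ l l′ → cX l ℚ.+ cY l ℚ.+ cZ l ≡ cX l′ ℚ.+ cY l′ ℚ.+ cZ l′ → cW l ≡ cW l′ →
                     ∀ L → ∏ L (localDensity l) ≡ ∏ L (localDensity l′)
    ∏-same-density l l′ eq₂ eq₃ L = ∏-cong L (λ q → trans (localDensity≡ l q)
      (trans (cong₂ (λ s w → 1ℚ ℚ.+ s ℚ.* recip² q ℚ.+ w ℚ.* recip³ q) eq₂ eq₃) (sym (localDensity≡ l′ q))))

    ∏-κ₀ : ∀ L → ∏ L (localDensity κ₀) ≡ 1ℚ
    ∏-κ₀ L = trans (∏-cong L (λ q → trans (localDensity≡ κ₀ q)
                     (solve 2 (λ x y → con 1ℚ :+ con 0ℚ :* x :+ con 0ℚ :* y := con 1ℚ) refl (recip² q) (recip³ q))))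
                   (∏-one L (λ _ → 1ℚ) (All.tabulate (λ _ → refl)))

  combine-∏localDensity : ∀ L → combine (λ κ → ∏ L (localDensity κ))
    ≡ 1ℚ ℚ.- ι 3 ℚ.* ∏ L (localDensity κᵃᵇ) ℚ.+ ι 3 ℚ.* ∏ L (localDensity κᵃ) ℚ.- ∏ L (localDensity κᵃᵇᶜ)
  combine-∏localDensity L = begin
    1ℚ ℚ.* F κ₀ ℚ.+ (ℚ.- 1ℚ ℚ.* D₁ ℚ.+ (ℚ.- 1ℚ ℚ.* F κᵃᶜ ℚ.+ (ℚ.- 1ℚ ℚ.* F κᵇᶜ ℚ.+ (1ℚ ℚ.* D₂
      ℚ.+ (1ℚ ℚ.* F κᵇ ℚ.+ (1ℚ ℚ.* F κᶜ ℚ.+ (ℚ.- 1ℚ ℚ.* D₃ ℚ.+ 0ℚ)))))))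
      ≡⟨ cong₂ (λ o x → 1ℚ ℚ.* o ℚ.+ (ℚ.- 1ℚ ℚ.* D₁ ℚ.+ (ℚ.- 1ℚ ℚ.* x ℚ.+ (ℚ.- 1ℚ ℚ.* F κᵇᶜ ℚ.+ (1ℚ ℚ.* D₂
                 ℚ.+ (1ℚ ℚ.* F κᵇ ℚ.+ (1ℚ ℚ.* F κᶜ ℚ.+ (ℚ.- 1ℚ ℚ.* D₃ ℚ.+ 0ℚ))))))))
               (∏-κ₀ L) (∏-same-density κᵃᶜ κᵃᵇ refl refl L) ⟩
    1ℚ ℚ.* 1ℚ ℚ.+ (ℚ.- 1ℚ ℚ.* D₁ ℚ.+ (ℚ.- 1ℚ ℚ.* D₁ ℚ.+ (ℚ.- 1ℚ ℚ.* F κᵇᶜ ℚ.+ (1ℚ ℚ.* D₂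
      ℚ.+ (1ℚ ℚ.* F κᵇ ℚ.+ (1ℚ ℚ.* F κᶜ ℚ.+ (ℚ.- 1ℚ ℚ.* D₃ ℚ.+ 0ℚ)))))))
      ≡⟨ cong₂ (λ x (y , z) → 1ℚ ℚ.* 1ℚ ℚ.+ (ℚ.- 1ℚ ℚ.* D₁ ℚ.+ (ℚ.- 1ℚ ℚ.* D₁ ℚ.+ (ℚ.- 1ℚ ℚ.* x ℚ.+ (1ℚ ℚ.* D₂
                 ℚ.+ (1ℚ ℚ.* y ℚ.+ (1ℚ ℚ.* z ℚ.+ (ℚ.- 1ℚ ℚ.* D₃ ℚ.+ 0ℚ))))))))
               (∏-same-density κᵇᶜ κᵃᵇ refl refl L)
               (cong₂ _,_ (∏-same-density κᵇ κᵃ refl refl L) (∏-same-density κᶜ κᵃ refl refl L)) ⟩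
    1ℚ ℚ.* 1ℚ ℚ.+ (ℚ.- 1ℚ ℚ.* D₁ ℚ.+ (ℚ.- 1ℚ ℚ.* D₁ ℚ.+ (ℚ.- 1ℚ ℚ.* D₁ ℚ.+ (1ℚ ℚ.* D₂
      ℚ.+ (1ℚ ℚ.* D₂ ℚ.+ (1ℚ ℚ.* D₂ ℚ.+ (ℚ.- 1ℚ ℚ.* D₃ ℚ.+ 0ℚ)))))))
      ≡⟨ solve 3 (λ d₁ d₂ d₃ → con 1ℚ :* con 1ℚ :+ (:- con 1ℚ :* d₁ :+ (:- con 1ℚ :* d₁ :+ (:- con 1ℚ :* d₁ :+ (con 1ℚ :* d₂
                      :+ (con 1ℚ :* d₂ :+ (con 1ℚ :* d₂ :+ (:- con 1ℚ :* d₃ :+ con 0ℚ)))))))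
                   := con 1ℚ :- con (ι 3) :* d₁ :+ con (ι 3) :* d₂ :- d₃) refl D₁ D₂ D₃ ⟩
    1ℚ ℚ.- ι 3 ℚ.* D₁ ℚ.+ ι 3 ℚ.* D₂ ℚ.- D₃ ∎
    where
      open ≡-Reasoning
      F : EulerExpansion.Coeffs → ℚ
      F κ = ∏ L (localDensity κ)
      D₁ = F κᵃᵇ
      D₂ = F κᵃ
      D₃ = F κᵃᵇᶜ

  primesUpTo-prime : ∀ P → All Prime (primesUpTo P)
  primesUpTo-prime P = AllP.all-filter prime? (range1 P)

  primesUpTo-unique : ∀ P → Unique (primesUpTo P)
  primesUpTo-unique P = UniqueP.filter⁺ prime? (UniqueP.applyUpTo⁺₁ suc P (λ i<j _ eq → ℕP.<⇒≢ i<j (ℕP.suc-injective eq)))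

  primesUpTo-covers : ∀ {H P} → H ℕ.≤ P → ∀ p → Prime p → p ℕ.≤ H → p ∈ primesUpTo P
  primesUpTo-covers H≤P zero prime0 _ = ⊥-elim (¬prime[0] prime0)
  primesUpTo-covers H≤P (suc p′) pp p≤H = ∈-filter⁺ prime? (∈-applyUpTo⁺ suc (ℕP.≤-trans p≤H H≤P)) pp

  toℚᵘ-combine-∏localDensity : ∀ P → toℚᵘ (combine (λ κ → ∏ (primesUpTo P) (localDensity κ))) ≃ ρTrunc P
  toℚᵘ-combine-∏localDensity P =
    ℚᵘP.≃-trans (ℚᵘP.≃-reflexive (cong toℚᵘ (combine-∏localDensity L)))
    (ℚᵘP.≃-trans (toℚᵘ-homo-+ (1ℚ ℚ.- ι 3 ℚ.* D₁ ℚ.+ ι 3 ℚ.* D₂) (ℚ.- D₃)) (ℚᵘP.+-cong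
      (ℚᵘP.≃-trans (toℚᵘ-homo-+ (1ℚ ℚ.- ι 3 ℚ.* D₁) (ι 3 ℚ.* D₂)) (ℚᵘP.+-cong
        (ℚᵘP.≃-trans (toℚᵘ-1- (ι 3 ℚ.* D₁)) (ℚᵘP.+-congʳ ℚᵘ.1ℚᵘ (ℚᵘP.-‿cong (toℚᵘ-3* D₁ (toℚᵘ-∏ L _ fac₁ pL fac₁≃)))))
        (toℚᵘ-3* D₂ (toℚᵘ-∏ L _ fac₂ pL fac₂≃))))
      (ℚᵘP.≃-trans (toℚᵘ-homo‿- D₃) (ℚᵘP.-‿cong (toℚᵘ-∏ L _ fac₃ pL fac₃≃)))))
    where
      L = primesUpTo P
      pL = primesUpTo-prime P
      D₁ = ∏ L (localDensity κᵃᵇ)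
      D₂ = ∏ L (localDensity κᵃ)
      D₃ = ∏ L (localDensity κᵃᵇᶜ)
      toℚᵘ-3* : ∀ x {y} → toℚᵘ x ≃ y → toℚᵘ (ι 3 ℚ.* x) ≃ ℕ→ℚ 3 ℚᵘ.* y
      toℚᵘ-3* x x≃y = ℚᵘP.≃-trans (toℚᵘ-homo-* (ι 3) x) (ℚᵘP.*-cong (toℚᵘ-ι 3) x≃y)
      local : ∀ {d m n} → d ≡ 1ℚ ℚ.- ι m ℚ.* recip (suc n) → toℚᵘ d ≃ ℚᵘ.1ℚᵘ ℚᵘ.- frac m (suc n)
      local {m = m} {n} refl = ℚᵘP.≃-trans (toℚᵘ-1- (ι m ℚ.* recip (suc n))) (ℚᵘP.+-congʳ ℚᵘ.1ℚᵘ (ℚᵘP.-‿cong (toℚᵘ-frac m n)))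
      fac₁≃ : ∀ p′ → toℚᵘ (localDensity κᵃᵇ (suc p′)) ≃ fac₁ (suc p′)
      fac₁≃ p′ = local {m = 1} (localDensity-κᵃᵇ p′)
      fac₂≃ : ∀ p′ → toℚᵘ (localDensity κᵃ (suc p′)) ≃ fac₂ (suc p′)
      fac₂≃ p′ = local {m = 2 ℕ.* suc p′ ℕ.∸ 1} (localDensity-κᵃ p′)
      fac₃≃ : ∀ p′ → toℚᵘ (localDensity κᵃᵇᶜ (suc p′)) ≃ fac₃ (suc p′)
      fac₃≃ p′ = local {m = 3 ℕ.* suc p′ ℕ.∸ 2} (localDensity-κᵃᵇᶜ p′)

  N3-estimate : ∀ H → 2 ℕ.≤ H → ∀ P → H ℕ.≤ P →
    let D = ℕ→ℚ (N3 H) ℚᵘ.- ρTrunc P ℚᵘ.* ℕ→ℚ (H ℕ.* H ℕ.* H)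
        B = ℕ→ℚ (1920 ℕ.* H ℕ.* H ℕ.* ⌊log₂ H ⌋ ℕ.* ⌊log₂ H ⌋)
    in ℚᵘ.- B ℚᵘ.≤ D × D ℚᵘ.≤ B
  N3-estimate H 2≤H P H≤P =
      ℚᵘP.≤-respˡ-≃ (ℚᵘP.≃-trans (toℚᵘ-homo‿- Bq) (ℚᵘP.-‿cong Bq≃B)) (ℚᵘP.≤-respʳ-≃ Dq≃D (ℚP.toℚᵘ-mono-≤ (proj₁ sandwich)))
    , ℚᵘP.≤-respˡ-≃ Dq≃D (ℚᵘP.≤-respʳ-≃ Bq≃B (ℚP.toℚᵘ-mono-≤ (proj₂ sandwich)))
    where
      L = primesUpTo P
      ℓ = ⌊log₂ H ⌋
      H³ = ι H ℚ.* ι H ℚ.* ι H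
      ρq = combine (λ κ → ∏ L (localDensity κ))
      Dq = ι (N3 H) ℚ.- ρq ℚ.* H³
      Bq = ι 8 ℚ.* (ι 240 ℚ.* (ι H ℚ.* ι H ℚ.* (ι ℓ ℚ.* ι ℓ)))
      sandwich : ℚ.- Bq ℚ.≤ Dq × Dq ℚ.≤ Bq
      sandwich = ∣p∣≤q⇒-q≤p≤q (N3≈ H 2≤H L (primesUpTo-prime P) (primesUpTo-unique P) (primesUpTo-covers H≤P))
      Bq≡ : Bq ≡ ι (1920 ℕ.* H ℕ.* H ℕ.* ℓ ℕ.* ℓ)
      Bq≡ = sym (begin
        ι (1920 ℕ.* H ℕ.* H ℕ.* ℓ ℕ.* ℓ)           ≡⟨ ι-* (1920 ℕ.* H ℕ.* H ℕ.* ℓ) ℓ ⟩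
        ι (1920 ℕ.* H ℕ.* H ℕ.* ℓ) ℚ.* ι ℓ         ≡⟨ cong (ℚ._* ι ℓ) (ι-* (1920 ℕ.* H ℕ.* H) ℓ) ⟩
        ι (1920 ℕ.* H ℕ.* H) ℚ.* ι ℓ ℚ.* ι ℓ       ≡⟨ cong (λ t → t ℚ.* ι ℓ ℚ.* ι ℓ) (trans (ι-* (1920 ℕ.* H) H) (cong (ℚ._* ι H) (ι-* 1920 H))) ⟩
        ι 1920 ℚ.* ι H ℚ.* ι H ℚ.* ι ℓ ℚ.* ι ℓ     ≡⟨ solve 2 (λ h l → con (ι 1920) :* h :* h :* l :* l
                                                          := con (ι 8) :* (con (ι 240) :* (h :* h :* (l :* l)))) refl (ι H) (ι ℓ) ⟩
        Bq ∎)
        where open ≡-Reasoning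
      Bq≃B : toℚᵘ Bq ≃ ℕ→ℚ (1920 ℕ.* H ℕ.* H ℕ.* ℓ ℕ.* ℓ)
      Bq≃B = ℚᵘP.≃-trans (ℚᵘP.≃-reflexive (cong toℚᵘ Bq≡)) (toℚᵘ-ι _)
      H³≃ : toℚᵘ H³ ≃ ℕ→ℚ (H ℕ.* H ℕ.* H)
      H³≃ = ℚᵘP.≃-trans (ℚᵘP.≃-reflexive (cong toℚᵘ (sym (trans (ι-* (H ℕ.* H) H) (cong (ℚ._* ι H) (ι-* H H)))))) (toℚᵘ-ι _)
      Dq≃D : toℚᵘ Dq ≃ ℕ→ℚ (N3 H) ℚᵘ.- ρTrunc P ℚᵘ.* ℕ→ℚ (H ℕ.* H ℕ.* H)
      Dq≃D = ℚᵘP.≃-trans (toℚᵘ-homo-+ (ι (N3 H)) (ℚ.- (ρq ℚ.* H³)))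
               (ℚᵘP.+-cong (toℚᵘ-ι (N3 H)) (ℚᵘP.≃-trans (toℚᵘ-homo‿- (ρq ℚ.* H³)) (ℚᵘP.-‿cong
                 (ℚᵘP.≃-trans (toℚᵘ-homo-* ρq H³) (ℚᵘP.*-cong (toℚᵘ-combine-∏localDensity P) H³≃)))))

open import Defs
open import Data.Nat using (ℕ; _≤_; _<_; s≤s; z≤n)
import Data.Nat as ℕ
open import Data.Nat.Logarithm using (⌊log₂_⌋)
open import Data.Product using (∃-syntax; _×_; _,_)
open import Data.Integer using (+_)
open import Data.Rational.Unnormalised.Base using (mkℚᵘ; _+_; _-_; _*_; -_) renaming (_≤_ to _≤ᵘ_)
open import Data.Rational.Unnormalised.Properties using (≤-trans; p≤p+q; neg-mono-≤)

theorem1 : ∃[ C ] (0 < C × (∀ (H : ℕ) → 2 ≤ H → ∀ (k : ℕ) → ∃[ P₀ ] ∀ (P : ℕ) → P₀ ≤ P →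
               (- (ℕ→ℚ (C ℕ.* H ℕ.* H ℕ.* ⌊log₂ H ⌋ ℕ.* ⌊log₂ H ⌋) + mkℚᵘ (+ 1) k)
                 ≤ᵘ (ℕ→ℚ (N3 H) - ρTrunc P * ℕ→ℚ (H ℕ.* H ℕ.* H)))
               × ((ℕ→ℚ (N3 H) - ρTrunc P * ℕ→ℚ (H ℕ.* H ℕ.* H))
                 ≤ᵘ (ℕ→ℚ (C ℕ.* H ℕ.* H ℕ.* ⌊log₂ H ⌋ ℕ.* ⌊log₂ H ⌋) + mkℚᵘ (+ 1) k))))
-- P₀ = H: once every prime up to H is in the product the bound holds without the slack 1/(k+1).
theorem1 = 1920 , s≤s z≤n , λ H 2≤H k → H , λ P H≤P →
  let (lower , upper) = Unnormalised.N3-estimate H 2≤H P H≤P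
      B = ℕ→ℚ (1920 ℕ.* H ℕ.* H ℕ.* ⌊log₂ H ⌋ ℕ.* ⌊log₂ H ⌋)
      B≤B+ε = p≤p+q B (mkℚᵘ (+ 1) k)
  in ≤-trans (neg-mono-≤ B≤B+ε) lower , ≤-trans upper B≤B+ε
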